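{- Let $n$ be a positive integer. For a partition $\lambda$ of length at most $n$, writing $\lambda+1^n=(\lambda_1+1,\dots,\lambda_n+1)$, \[ \mathrm{rs}_{\lambda,\lambda}=\mathrm{so}_\lambda\,\mathrm{so}^-_\lambda,\qquad \mathrm{rs}_{\lambda+1^n,\lambda}=\mathrm{o}_{\lambda+1^n}\,\mathrm{sp}_\lambda. \] Moreover, for a partition $\lambda$ of length at most $n+1$, \[ \mathrm{rs}_{(\lambda_1,\dots,\lambda_n),(\lambda_2,\dots,\lambda_{n+1})}+\mathrm{rs}_{(\lambda_1-1,\dots,\lambda_{n+1}-1),(\lambda_2+1,\dots,\lambda_n+1)}=\mathrm{sp}_{(\lambda_1,\dots,\lambda_n)}\,\mathrm{o}_{(\lambda_2,\dots,\lambda_{n+1})}, \] and \[ \mathrm{rs}_{(\lambda_1+1,\dots,\lambda_n+1),(\lambda_2,\dots,\lambda_{n+1})}+\mathrm{rs}_{(\lambda_1,\dots,\lambda_{n+1}),(\lambda_2+1,\dots,\lambda_n+1)}=\mathrm{so}_{(\lambda_1+1,\dots,\lambda_n+1)}\,\mathrm{so}^-_{(\lambda_2,\dots,\lambda_{n+1})}. \]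
   Context: $\Lambda$ is the ring of symmetric functions; $h_r$ complete homogeneous symmetric functions, $h_0=1$, $h_r=0$ for $r<0$. For a weakly decreasing integer sequence $\alpha=(\alpha_1,\dots,\alpha_N)$: $\mathrm{o}_\alpha=\det_{1\le i,j\le N}(h_{\alpha_i-i+j}-h_{\alpha_i-i-j})$, $\mathrm{sp}_\alpha=\tfrac12\det_{1\le i,j\le N}(h_{\alpha_i-i+j}+h_{\alpha_i-i-j+2})$, $\mathrm{so}_\alpha=\det_{1\le i,j\le N}(h_{\alpha_i-i+j}+h_{\alpha_i-i-j+1})$, $\mathrm{so}^-_\alpha=\det_{1\le i,j\le N}(h_{\alpha_i-i+j}-h_{\alpha_i-i-j+1})$ (for partitions these do not depend on padding with zeros). For sequences $\alpha$ of length $N$ and $\beta$ of length $M$, \[ \mathrm{rs}_{\alpha,\beta}=\det\begin{pmatrix}(h_{\alpha_i-i+j})_{1\le i,j\le N}&(h_{\alpha_i-i-j+1})_{1\le i\le N,1\le j\le M}\\(h_{\beta_i-i-j+1})_{1\le i\le M,1\le j\le N}&(h_{\beta_i-i+j})_{1\le i,j\le M}\end{pmatrix}; \] for partitions $\alpha,\beta$ this equals $\sum_\nu(-1)^{|\nu|}s_{\alpha/\nu}s_{\beta/\nu'}$, where $s_{\lambda/\mu}=\det(h_{\lambda_i-\mu_j-i+j})$ is the skew Schur function and $\nu'$ the conjugate partition. -}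

module Defs where

open import Level using (Level)
open import Algebra.Bundles using (CommutativeRing)
open import Data.Nat as ℕ using (ℕ; zero; suc)
open import Data.Integer as ℤ using (ℤ; +_; -[1+_])
open import Data.Fin using (Fin; zero; suc; toℕ; punchIn; splitAt)
open import Data.Sum using (inj₁; inj₂)

-- A partition with at most N parts, padded by zeros to exactly N parts:
-- a weakly decreasing function Fin N → ℕ.
IsPartition : ∀ {N} → (Fin N → ℕ) → Set
IsPartition {N} lam = ∀ (i j : Fin N) → toℕ i ℕ.≤ toℕ j → lam j ℕ.≤ lam i

-- Λ = ℤ[h₁,h₂,…] with the hᵣ algebraically independent.  An identity holds
-- in Λ iff it holds for every commutative ring R and every choice of values
-- g k = h_{k+1} ∈ R (specialisation homomorphism).
module Sym {c ℓ : Level} (R : CommutativeRing c ℓ)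
           (g : ℕ → CommutativeRing.Carrier R) where
  open CommutativeRing R using (Carrier; _+_; _*_; -_; _-_; 0#; 1#)

  h : ℤ → Carrier
  h (+ zero)    = 1#
  h (+ suc k)   = g k
  h -[1+ _ ]    = 0#

  sumFin : ∀ {N} → (Fin N → Carrier) → Carrier
  sumFin {zero}  f = 0#
  sumFin {suc N} f = f zero + sumFin (λ j → f (suc j))

  sgn : ℕ → Carrier → Carrier
  sgn zero    x = x
  sgn (suc k) x = - sgn k x

  det : ∀ {N} → (Fin N → Fin N → Carrier) → Carrier
  det {zero}  M = 1#
  det {suc N} M =
    sumFin (λ j → sgn (toℕ j) (M zero j * det (λ i k → M (suc i) (punchIn j k))))

  ι : ∀ {N} → Fin N → ℤ
  ι i = + suc (toℕ i)

  o : ∀ {N} → (Fin N → ℤ) → Carrier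
  o α = det (λ i j → h (α i ℤ.- ι i ℤ.+ ι j) - h (α i ℤ.- ι i ℤ.- ι j))

  -- sp_α = ½ det(h_{αᵢ-i+j} + h_{αᵢ-i-j+2}).  The first column has entries
  -- 2·h_{αᵢ-i+1}; halving that column gives the same value with no division.
  sp : ∀ {N} → (Fin N → ℤ) → Carrier
  sp {N} α = det (λ i j → spEntry i j)
    where
      spEntry : Fin N → Fin N → Carrier
      spEntry i zero    = h (α i ℤ.- ι i ℤ.+ + 1)
      spEntry i (suc j) = h (α i ℤ.- ι i ℤ.+ ι (suc j))
                        + h (α i ℤ.- ι i ℤ.- ι (suc j) ℤ.+ + 2)

  so : ∀ {N} → (Fin N → ℤ) → Carrier
  so α = det (λ i j → h (α i ℤ.- ι i ℤ.+ ι j) + h (α i ℤ.- ι i ℤ.- ι j ℤ.+ + 1))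

  so⁻ : ∀ {N} → (Fin N → ℤ) → Carrier
  so⁻ α = det (λ i j → h (α i ℤ.- ι i ℤ.+ ι j) - h (α i ℤ.- ι i ℤ.- ι j ℤ.+ + 1))

  rs : ∀ {N M} → (Fin N → ℤ) → (Fin M → ℤ) → Carrier
  rs {N} {M} α β = det entry
    where
      entry : Fin (N ℕ.+ M) → Fin (N ℕ.+ M) → Carrier
      entry a b with splitAt N a | splitAt N b
      ... | inj₁ i | inj₁ j = h (α i ℤ.- ι i ℤ.+ ι j)
      ... | inj₁ i | inj₂ j = h (α i ℤ.- ι i ℤ.- ι j ℤ.+ + 1)
      ... | inj₂ i | inj₁ j = h (β i ℤ.- ι i ℤ.- ι j ℤ.+ + 1)
      ... | inj₂ i | inj₂ j = h (β i ℤ.- ι i ℤ.+ ι j)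

{-# OPTIONS --safe #-}
-- Every rs matrix is a block matrix [[A, B], [C, D]] whose entries are values h_{r + c} at a
-- row offset r and a column offset c.  In rs_{λ,λ} and rs_{λ+1,λ} the lower block row is the
-- upper one with the column offsets reflected; subtracting one block row from the other leaves
-- rows that are antisymmetric under this reflection, and adding suitable columns of one block
-- column to the other then clears an off-diagonal block.  The remaining diagonal blocks are
-- the so, so⁻, o and sp matrices.  For the last two identities, moving one row and one column
-- of the second rs matrix (total sign -1) makes it agree with the first rs matrix outside the
-- last row, so by linearity the sum is a single determinant; its lower rows are again
-- antisymmetric under a reflection, and the same column operations finish the proof.
module Submission where

open import Defs
open import Level using (Level)
open import Algebra.Bundles using (CommutativeRing)
open import Data.Nat as ℕ using (ℕ; zero; suc; _<_; _≤_; z≤n; s≤s)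
import Data.Nat.Properties as ℕ
open import Data.Integer as ℤ using (ℤ; +_)
import Data.Integer.Properties as ℤ
open import Data.Fin as Fin using (Fin; zero; suc; toℕ; punchIn; splitAt; inject₁)
import Data.Fin.Properties as Fin
open import Data.Sum using (inj₁; inj₂)
open import Data.Empty using (⊥-elim)
open import Data.Bool using (Bool; true; false; not)
open import Data.Product using (_,_; _×_; proj₁; proj₂)
open import Relation.Nullary using (yes; no; ¬_)
open import Relation.Binary.Definitions using (tri<; tri≈; tri>)
open import Relation.Binary.PropositionalEquality as ≡ using (_≡_; _≢_)
import Algebra.Properties.Ring as RingProperties
import Algebra.Properties.CommutativeSemigroup as CommutativeSemigroupProperties
open import Data.Integer.Tactic.RingSolver using (solve-∀)

extend : ∀ {a} {A : Set a} {K} → A → (Fin K → A) → ℕ → A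
extend {K = zero}  d f k       = d
extend {K = suc K} d f zero    = f zero
extend {K = suc K} d f (suc k) = extend d (λ i → f (suc i)) k

extend-toℕ : ∀ {a} {A : Set a} {K} (d : A) (f : Fin K → A) (i : Fin K) → extend d f (toℕ i) ≡ f i
extend-toℕ d f zero    = ≡.refl
extend-toℕ d f (suc i) = extend-toℕ d (λ i → f (suc i)) i

module Determinant {c ℓ : Level} (R : CommutativeRing c ℓ) where
  open CommutativeRing R hiding (zero)
  open RingProperties ring using (-‿distribˡ-*; -‿distribʳ-*; -‿involutive; -‿+-comm; -0#≈0#; -1*x≈-x)
  open CommutativeSemigroupProperties +-commutativeSemigroup using () renaming (interchange to +-interchange)
  open CommutativeSemigroupProperties *-commutativeSemigroup using () renaming (x∙yz≈y∙xz to *-left-comm)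
  open import Relation.Binary.Reasoning.Setoid setoid

  Matrix : Set c
  Matrix = ℕ → ℕ → Carrier

  transpose : Matrix → Matrix
  transpose F i j = F j i

  differences-cancel : ∀ p q → (q + - 1# * p) + 1# * (p + - 1# * q) ≈ 0#
  differences-cancel p q = begin
    (q + - 1# * p) + 1# * (p + - 1# * q) ≈⟨ +-cong (+-congˡ (-1*x≈-x p)) (trans (*-identityˡ _) (+-congˡ (-1*x≈-x q))) ⟩
    (q + - p) + (p + - q)                ≈⟨ +-interchange q (- p) p (- q) ⟩
    (q + p) + (- p + - q)                ≈⟨ +-cong (+-comm q p) (-‿+-comm p q) ⟩
    (p + q) + - (p + q)                  ≈⟨ -‿inverseʳ _ ⟩
    0#                                   ∎

  [0<_] : ℕ → Carrier
  [0< zero  ] = 0#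
  [0< suc _ ] = 1#

  signed : ℕ → Carrier → Carrier
  signed zero    x = x
  signed (suc k) x = - signed k x

  signed-cong : ∀ k {x y} → x ≈ y → signed k x ≈ signed k y
  signed-cong zero    e = e
  signed-cong (suc k) e = -‿cong (signed-cong k e)

  signed-+ : ∀ k x y → signed k (x + y) ≈ signed k x + signed k y
  signed-+ zero    x y = refl
  signed-+ (suc k) x y = trans (-‿cong (signed-+ k x y)) (sym (-‿+-comm _ _))

  signed-*ˡ : ∀ k x y → signed k (x * y) ≈ x * signed k y
  signed-*ˡ zero    x y = refl
  signed-*ˡ (suc k) x y = trans (-‿cong (signed-*ˡ k x y)) (-‿distribʳ-* x _)

  signed-*ʳ : ∀ k x y → signed k (x * y) ≈ signed k x * y
  signed-*ʳ zero    x y = refl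
  signed-*ʳ (suc k) x y = trans (-‿cong (signed-*ʳ k x y)) (-‿distribˡ-* _ y)

  signed-neg : ∀ k x → signed k (- x) ≈ - signed k x
  signed-neg zero    x = refl
  signed-neg (suc k) x = -‿cong (signed-neg k x)

  signed-0 : ∀ k → signed k 0# ≈ 0#
  signed-0 zero    = refl
  signed-0 (suc k) = trans (-‿cong (signed-0 k)) -0#≈0#

  signed-involutive : ∀ k x → signed k (signed k x) ≈ x
  signed-involutive zero    x = refl
  signed-involutive (suc k) x =
    trans (-‿cong (signed-neg k _)) (trans (-‿involutive _) (signed-involutive k x))

  signed-comm : ∀ k l x → signed k (signed l x) ≈ signed l (signed k x)
  signed-comm zero    l x = refl
  signed-comm (suc k) l x = trans (-‿cong (signed-comm k l x)) (sym (signed-neg l _))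

  sumTo : ℕ → (ℕ → Carrier) → Carrier
  sumTo zero    f = 0#
  sumTo (suc n) f = f 0 + sumTo n (λ j → f (suc j))

  sumTo-cong : ∀ n {f g : ℕ → Carrier} → (∀ j → j < n → f j ≈ g j) → sumTo n f ≈ sumTo n g
  sumTo-cong zero    e = refl
  sumTo-cong (suc n) e = +-cong (e 0 (s≤s z≤n)) (sumTo-cong n (λ j j<n → e (suc j) (s≤s j<n)))

  sumTo-zero : ∀ n {f : ℕ → Carrier} → (∀ j → j < n → f j ≈ 0#) → sumTo n f ≈ 0#
  sumTo-zero zero    e = refl
  sumTo-zero (suc n) e =
    trans (+-cong (e 0 (s≤s z≤n)) (sumTo-zero n (λ j j<n → e (suc j) (s≤s j<n)))) (+-identityʳ 0#)

  sumTo-distrib-+ : ∀ n (f g : ℕ → Carrier) → sumTo n (λ j → f j + g j) ≈ sumTo n f + sumTo n g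
  sumTo-distrib-+ zero    f g = sym (+-identityʳ 0#)
  sumTo-distrib-+ (suc n) f g = trans (+-congˡ (sumTo-distrib-+ n _ _)) (+-interchange _ _ _ _)

  *-distribˡ-sumTo : ∀ n a (f : ℕ → Carrier) → a * sumTo n f ≈ sumTo n (λ j → a * f j)
  *-distribˡ-sumTo zero    a f = zeroʳ a
  *-distribˡ-sumTo (suc n) a f = trans (distribˡ a _ _) (+-congˡ (*-distribˡ-sumTo n a _))

  *-distribʳ-sumTo : ∀ n a (f : ℕ → Carrier) → sumTo n f * a ≈ sumTo n (λ j → f j * a)
  *-distribʳ-sumTo n a f =
    trans (*-comm _ a) (trans (*-distribˡ-sumTo n a f) (sumTo-cong n (λ j _ → *-comm a (f j))))

  signed-sumTo : ∀ k n (f : ℕ → Carrier) → signed k (sumTo n f) ≈ sumTo n (λ j → signed k (f j))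
  signed-sumTo k zero    f = signed-0 k
  signed-sumTo k (suc n) f = trans (signed-+ k _ _) (+-congˡ (signed-sumTo k n _))

  sumTo-+ : ∀ a b (f : ℕ → Carrier) → sumTo (a ℕ.+ b) f ≈ sumTo a f + sumTo b (λ j → f (a ℕ.+ j))
  sumTo-+ zero    b f = sym (+-identityˡ _)
  sumTo-+ (suc a) b f = trans (+-congˡ (sumTo-+ a b _)) (sym (+-assoc _ _ _))

  sumTo-comm : ∀ n k (f : ℕ → ℕ → Carrier) →
               sumTo n (λ i → sumTo k (f i)) ≈ sumTo k (λ j → sumTo n (λ i → f i j))
  sumTo-comm zero    k f = sym (sumTo-zero k (λ _ _ → refl))
  sumTo-comm (suc n) k f =
    trans (+-congˡ (sumTo-comm n k (λ i → f (suc i)))) (sym (sumTo-distrib-+ k _ _))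

  -- Determinants of ℕ-indexed matrices

  punchInℕ : ℕ → ℕ → ℕ
  punchInℕ zero    k       = suc k
  punchInℕ (suc j) zero    = zero
  punchInℕ (suc j) (suc k) = suc (punchInℕ j k)

  minor : Matrix → ℕ → Matrix
  minor F j i k = F (suc i) (punchInℕ j k)

  detℕ : ℕ → Matrix → Carrier
  detℕ zero    F = 1#
  detℕ (suc K) F = sumTo (suc K) (λ j → signed j (F 0 j * detℕ K (minor F j)))

  punchInℕ-< : ∀ {K} j k → k < K → punchInℕ j k < suc K
  punchInℕ-< zero    k       k<K       = s≤s k<K
  punchInℕ-< (suc j) zero    k<K       = s≤s z≤n
  punchInℕ-< (suc j) (suc k) (s≤s k<K) = s≤s (punchInℕ-< j k k<K)

  punchInℕ-≥ : ∀ j k → j ≤ k → punchInℕ j k ≡ suc k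
  punchInℕ-≥ zero    k       _         = ≡.refl
  punchInℕ-≥ (suc j) (suc k) (s≤s j≤k) = ≡.cong suc (punchInℕ-≥ j k j≤k)

  detℕ-cong : ∀ K {F G : Matrix} → (∀ i j → i < K → j < K → F i j ≈ G i j) → detℕ K F ≈ detℕ K G
  detℕ-cong zero    e = refl
  detℕ-cong (suc K) e = sumTo-cong (suc K) (λ j j< → signed-cong j (*-cong (e 0 j (s≤s z≤n) j<)
    (detℕ-cong K (λ i k i< k< → e (suc i) (punchInℕ j k) (s≤s i<) (punchInℕ-< j k k<)))))

  -- Both sides expand, via row 0 and then column 0 of the minors, into the same double sum.
  detℕ-transpose : ∀ K (F : Matrix) → detℕ K (transpose F) ≈ detℕ K F
  detℕ-transpose zero          F = refl
  detℕ-transpose (suc zero)    F = refl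
  detℕ-transpose (suc (suc K)) F = +-cong
      (*-congˡ (detℕ-transpose (suc K) (λ a b → F (suc a) (suc b))))
      (begin
        sumTo (suc K) (λ i → signed (suc i) (F (suc i) 0 * detℕ (suc K) (λ a b → F (punchInℕ (suc i) b) (suc a))))
          ≈⟨ sumTo-cong (suc K) (λ i _ → signed-cong (suc i) (*-congˡ {F (suc i) 0} (detℕ-transpose (suc K) (λ a b → F (punchInℕ (suc i) a) (suc b))))) ⟩
        sumTo (suc K) (λ i → signed (suc i) (F (suc i) 0 * sumTo (suc K) (λ j → signed j (F 0 (suc j) * detℕ K (d i j)))))
          ≈⟨ sumTo-cong (suc K) (λ i _ → signed-cong (suc i) (*-distribˡ-sumTo (suc K) (F (suc i) 0) (λ j → signed j (F 0 (suc j) * detℕ K (d i j))))) ⟩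
        sumTo (suc K) (λ i → signed (suc i) (sumTo (suc K) (λ j → F (suc i) 0 * signed j (F 0 (suc j) * detℕ K (d i j)))))
          ≈⟨ sumTo-cong (suc K) (λ i _ → signed-sumTo (suc i) (suc K) (λ j → F (suc i) 0 * signed j (F 0 (suc j) * detℕ K (d i j)))) ⟩
        sumTo (suc K) (λ i → sumTo (suc K) (λ j → signed (suc i) (F (suc i) 0 * signed j (F 0 (suc j) * detℕ K (d i j)))))
          ≈⟨ sumTo-cong (suc K) (λ i _ → sumTo-cong (suc K) (λ j _ → expandRowFirst i j)) ⟩
        sumTo (suc K) (λ i → sumTo (suc K) (λ j → - t i j))
          ≈⟨ sumTo-comm (suc K) (suc K) (λ i j → - t i j) ⟩
        sumTo (suc K) (λ j → sumTo (suc K) (λ i → - t i j))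
          ≈⟨ sym (sumTo-cong (suc K) (λ j _ → sumTo-cong (suc K) (λ i _ → expandColumnFirst i j))) ⟩
        sumTo (suc K) (λ j → sumTo (suc K) (λ i → signed (suc j) (F 0 (suc j) * signed i (F (suc i) 0 * detℕ K (d′ i j)))))
          ≈⟨ sym (sumTo-cong (suc K) (λ j _ → signed-sumTo (suc j) (suc K) (λ i → F 0 (suc j) * signed i (F (suc i) 0 * detℕ K (d′ i j))))) ⟩
        sumTo (suc K) (λ j → signed (suc j) (sumTo (suc K) (λ i → F 0 (suc j) * signed i (F (suc i) 0 * detℕ K (d′ i j)))))
          ≈⟨ sym (sumTo-cong (suc K) (λ j _ → signed-cong (suc j) (*-distribˡ-sumTo (suc K) (F 0 (suc j)) (λ i → signed i (F (suc i) 0 * detℕ K (d′ i j)))))) ⟩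
        sumTo (suc K) (λ j → signed (suc j) (F 0 (suc j) * sumTo (suc K) (λ i → signed i (F (suc i) 0 * detℕ K (d′ i j)))))
          ≈⟨ sumTo-cong (suc K) (λ j _ → signed-cong (suc j) (*-congˡ {F 0 (suc j)} (detℕ-transpose (suc K) (λ a b → F (suc a) (punchInℕ (suc j) b))))) ⟩
        sumTo (suc K) (λ j → signed (suc j) (F 0 (suc j) * detℕ (suc K) (λ a b → F (suc a) (punchInℕ (suc j) b)))) ∎)
    where
    d d′ : ℕ → ℕ → Matrix
    d  i j a b = F (suc (punchInℕ i a)) (suc (punchInℕ j b))
    d′ i j a b = F (suc (punchInℕ i b)) (punchInℕ (suc j) (suc a))
    t : ℕ → ℕ → Carrier
    t i j = signed i (signed j (F 0 (suc j) * (F (suc i) 0 * detℕ K (d i j))))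
    expandRowFirst : ∀ i j → signed (suc i) (F (suc i) 0 * signed j (F 0 (suc j) * detℕ K (d i j))) ≈ - t i j
    expandRowFirst i j =
      -‿cong (signed-cong i (trans (sym (signed-*ˡ j _ _)) (signed-cong j (*-left-comm _ _ _))))
    expandColumnFirst : ∀ i j → signed (suc j) (F 0 (suc j) * signed i (F (suc i) 0 * detℕ K (d′ i j))) ≈ - t i j
    expandColumnFirst i j = -‿cong (begin
      signed j (F 0 (suc j) * signed i (F (suc i) 0 * detℕ K (d′ i j)))
        ≈⟨ signed-cong j (*-congˡ (signed-cong i (*-congˡ (detℕ-transpose K (d i j))))) ⟩
      signed j (F 0 (suc j) * signed i (F (suc i) 0 * detℕ K (d i j)))
        ≈⟨ signed-cong j (sym (signed-*ˡ i _ _)) ⟩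
      signed j (signed i (F 0 (suc j) * (F (suc i) 0 * detℕ K (d i j))))
        ≈⟨ signed-comm j i _ ⟩
      t i j ∎)

  swap₀₁ : ℕ → ℕ
  swap₀₁ zero                = suc zero
  swap₀₁ (suc zero)          = zero
  swap₀₁ (suc (suc k))       = suc (suc k)

  detℕ-swapColumns₀₁-minor : ∀ {K} (F : Matrix) j → j < K →
      detℕ (suc K) (minor (λ i j → F i (swap₀₁ j)) (suc (suc j))) ≈ - detℕ (suc K) (minor F (suc (suc j)))

  -- the first two Laplace terms exchange; the others are minors with two columns swapped
  detℕ-swapColumns₀₁ : ∀ K (F : Matrix) →
                       detℕ (suc (suc K)) (λ i j → F i (swap₀₁ j)) ≈ - detℕ (suc (suc K)) F
  detℕ-swapColumns₀₁ K F = begin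
    F 0 1 * detℕ (suc K) (minor F′ 0) + (- (F 0 0 * detℕ (suc K) (minor F′ 1)) + sumTo K (laplace F′))
      ≈⟨ +-cong (*-congˡ (detℕ-cong (suc K) (λ a b _ _ → column0 a b)))
                (+-cong (-‿cong (*-congˡ (detℕ-cong (suc K) (λ a b _ _ → column1 a b))))
                        (trans (sumTo-cong K laterColumns) (sym (signed-sumTo 1 K (laplace F))))) ⟩
    F 0 1 * detℕ (suc K) (minor F 1) + (- (F 0 0 * detℕ (suc K) (minor F 0)) + - sumTo K (laplace F))
      ≈⟨ swapTerms _ _ _ ⟩
    - (F 0 0 * detℕ (suc K) (minor F 0) + (- (F 0 1 * detℕ (suc K) (minor F 1)) + sumTo K (laplace F))) ∎
    where
    F′ : Matrix
    F′ i j = F i (swap₀₁ j)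
    laplace : Matrix → ℕ → Carrier
    laplace G j = signed (suc (suc j)) (G 0 (suc (suc j)) * detℕ (suc K) (minor G (suc (suc j))))
    column0 : ∀ a b → minor F′ 0 a b ≈ minor F 1 a b
    column0 a zero    = refl
    column0 a (suc b) = refl
    column1 : ∀ a b → minor F′ 1 a b ≈ minor F 0 a b
    column1 a zero    = refl
    column1 a (suc b) = refl
    swapTerms : ∀ a b x → b + (- a + - x) ≈ - (a + (- b + x))
    swapTerms a b x = begin
      b + (- a + - x)     ≈⟨ sym (+-assoc b (- a) (- x)) ⟩
      (b + - a) + - x     ≈⟨ +-congʳ (+-comm b (- a)) ⟩
      (- a + b) + - x     ≈⟨ +-assoc (- a) b (- x) ⟩
      - a + (b + - x)     ≈⟨ +-congˡ (+-congʳ (sym (-‿involutive b))) ⟩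
      - a + (- - b + - x) ≈⟨ +-congˡ (-‿+-comm (- b) x) ⟩
      - a + - (- b + x)   ≈⟨ -‿+-comm a _ ⟩
      - (a + (- b + x))   ∎
    laterColumns : ∀ j → j < K → laplace F′ j ≈ - laplace F j
    laterColumns j j<K = trans (signed-cong (suc (suc j)) (trans (*-congˡ (detℕ-swapColumns₀₁-minor F j j<K))
                                 (sym (-‿distribʳ-* _ _))))
                               (signed-neg (suc (suc j)) _)

  detℕ-swapColumns₀₁-minor {suc K} F j _ =
    trans (detℕ-cong (suc (suc K)) (λ a b _ _ → commute a b)) (detℕ-swapColumns₀₁ K (minor F (suc (suc j))))
    where
    commute : ∀ a b → F (suc a) (swap₀₁ (punchInℕ (suc (suc j)) b)) ≈ F (suc a) (punchInℕ (suc (suc j)) (swap₀₁ b))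
    commute a zero          = refl
    commute a (suc zero)    = refl
    commute a (suc (suc b)) = refl

  detℕ-equalColumns₀₁-minor : ∀ {K} (F : Matrix) j → j < K → (∀ i → F i 0 ≈ F i 1) →
                              detℕ (suc K) (minor F (suc (suc j))) ≈ 0#

  detℕ-equalColumns₀₁ : ∀ K (F : Matrix) → (∀ i → F i 0 ≈ F i 1) → detℕ (suc (suc K)) F ≈ 0#
  detℕ-equalColumns₀₁ K F e = begin
    F 0 0 * detℕ (suc K) (minor F 0) + (- (F 0 1 * detℕ (suc K) (minor F 1)) + sumTo K laplace)
      ≈⟨ sym (+-assoc _ _ _) ⟩
    (F 0 0 * detℕ (suc K) (minor F 0) + - (F 0 1 * detℕ (suc K) (minor F 1))) + sumTo K laplace
      ≈⟨ +-cong (trans (+-congʳ (*-cong (e 0) (detℕ-cong (suc K) (λ a b _ _ → sameMinor a b)))) (-‿inverseʳ _))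
                (sumTo-zero K laterColumns) ⟩
    0# + 0# ≈⟨ +-identityʳ 0# ⟩
    0# ∎
    where
    laplace : ℕ → Carrier
    laplace j = signed (suc (suc j)) (F 0 (suc (suc j)) * detℕ (suc K) (minor F (suc (suc j))))
    sameMinor : ∀ a b → minor F 0 a b ≈ minor F 1 a b
    sameMinor a zero    = sym (e (suc a))
    sameMinor a (suc b) = refl
    laterColumns : ∀ j → j < K → laplace j ≈ 0#
    laterColumns j j<K = trans (signed-cong (suc (suc j))
      (trans (*-congˡ (detℕ-equalColumns₀₁-minor F j j<K e)) (zeroʳ _))) (signed-0 (suc (suc j)))

  detℕ-equalColumns₀₁-minor {suc K} F j _ e = detℕ-equalColumns₀₁ K (minor F (suc (suc j))) (λ i → e (suc i))

  detℕ-swapRows₀₁ : ∀ K (F : Matrix) → detℕ (suc (suc K)) (λ i j → F (swap₀₁ i) j) ≈ - detℕ (suc (suc K)) F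
  detℕ-swapRows₀₁ K F = begin
    detℕ (suc (suc K)) (λ i j → F (swap₀₁ i) j) ≈⟨ detℕ-transpose (suc (suc K)) (λ i j → F (swap₀₁ j) i) ⟩
    detℕ (suc (suc K)) (λ i j → F (swap₀₁ j) i) ≈⟨ detℕ-swapColumns₀₁ K (transpose F) ⟩
    - detℕ (suc (suc K)) (transpose F)           ≈⟨ -‿cong (detℕ-transpose (suc (suc K)) F) ⟩
    - detℕ (suc (suc K)) F                       ∎

  detℕ-equalRows₀₁ : ∀ K (F : Matrix) → (∀ j → F 0 j ≈ F 1 j) → detℕ (suc (suc K)) F ≈ 0#
  detℕ-equalRows₀₁ K F e =
    trans (sym (detℕ-transpose (suc (suc K)) F)) (detℕ-equalColumns₀₁ K (transpose F) e)

  detℕ-zero-viaMinors : ∀ K (F : Matrix) → (∀ j → j < suc K → detℕ K (minor F j) ≈ 0#) → detℕ (suc K) F ≈ 0#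
  detℕ-zero-viaMinors K F e = sumTo-zero (suc K) (λ j j< →
    trans (signed-cong j (trans (*-congˡ {F 0 j} (e j j<)) (zeroʳ _))) (signed-0 j))

  detℕ-neg-viaMinors : ∀ K (F G : Matrix) → (∀ j → G 0 j ≈ F 0 j) →
                       (∀ j → j < suc K → detℕ K (minor G j) ≈ - detℕ K (minor F j)) →
                       detℕ (suc K) G ≈ - detℕ (suc K) F
  detℕ-neg-viaMinors K F G e₀ e = trans (sumTo-cong (suc K) (λ j j< → trans
      (signed-cong j (trans (*-cong (e₀ j) (e j j<)) (sym (-‿distribʳ-* _ _)))) (signed-neg j _)))
    (sym (signed-sumTo 1 (suc K) (λ j → signed j (F 0 j * detℕ K (minor F j)))))

  detℕ-linear-viaMinors : ∀ K (E X Y : Matrix) a →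
    (∀ j → j < suc K → E 0 j * detℕ K (minor E j) ≈ X 0 j * detℕ K (minor X j) + a * (Y 0 j * detℕ K (minor Y j))) →
    detℕ (suc K) E ≈ detℕ (suc K) X + a * detℕ (suc K) Y
  detℕ-linear-viaMinors K E X Y a e = begin
    detℕ (suc K) E
      ≈⟨ sumTo-cong (suc K) (λ j j< → trans (signed-cong j (e j j<))
                                      (trans (signed-+ j _ _) (+-congˡ (signed-*ˡ j a _)))) ⟩
    sumTo (suc K) (λ j → x j + a * y j)
      ≈⟨ sumTo-distrib-+ (suc K) x (λ j → a * y j) ⟩
    sumTo (suc K) x + sumTo (suc K) (λ j → a * y j)
      ≈⟨ +-congˡ (sym (*-distribˡ-sumTo (suc K) a y)) ⟩
    detℕ (suc K) X + a * detℕ (suc K) Y ∎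
    where
    x y : ℕ → Carrier
    x j = signed j (X 0 j * detℕ K (minor X j))
    y j = signed j (Y 0 j * detℕ K (minor Y j))

  swapAt : ℕ → ℕ → ℕ
  swapAt zero    i       = swap₀₁ i
  swapAt (suc r) zero    = zero
  swapAt (suc r) (suc i) = suc (swapAt r i)

  swapAt-self : ∀ r → swapAt r r ≡ suc r
  swapAt-self zero    = ≡.refl
  swapAt-self (suc r) = ≡.cong suc (swapAt-self r)

  detℕ-swapRows : ∀ r K (F : Matrix) → suc r < K → detℕ K (λ i j → F (swapAt r i) j) ≈ - detℕ K F
  detℕ-swapRows zero    (suc (suc K)) F _           = detℕ-swapRows₀₁ K F
  detℕ-swapRows zero    (suc zero)    F (s≤s ())
  detℕ-swapRows (suc r) (suc K)       F (s≤s r+1<K) =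
    detℕ-neg-viaMinors K F (λ i j → F (swapAt (suc r) i) j) (λ _ → refl) (λ j _ → detℕ-swapRows r K (minor F j) r+1<K)

  detℕ-equalRows-at : ∀ d r K (F : Matrix) → suc r ℕ.+ d < K → (∀ j → F r j ≈ F (suc r ℕ.+ d) j) → detℕ K F ≈ 0#
  detℕ-equalRows-at zero    zero    (suc (suc K)) F _  e = detℕ-equalRows₀₁ K F e
  detℕ-equalRows-at zero    zero    (suc zero)    F (s≤s ()) e
  detℕ-equalRows-at (suc d) zero    K             F lt e = begin
    detℕ K F                                  ≈⟨ sym (-‿involutive _) ⟩
    - - detℕ K F                              ≈⟨ -‿cong (sym (detℕ-swapRows (suc d) K F lt)) ⟩
    - detℕ K (λ i j → F (swapAt (suc d) i) j) ≈⟨ -‿cong (detℕ-equalRows-at d zero K (λ i j → F (swapAt (suc d) i) j) (ℕ.<-trans (ℕ.n<1+n _) lt) swapped) ⟩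
    - 0#                                      ≈⟨ -0#≈0# ⟩
    0#                                        ∎
    where
    swapped : ∀ j → F 0 j ≈ F (suc (swapAt d d)) j
    swapped j = trans (e j) (reflexive (≡.cong (λ z → F (suc z) j) (≡.sym (swapAt-self d))))
  detℕ-equalRows-at d (suc r) (suc K) F (s≤s lt) e =
    detℕ-zero-viaMinors K F (λ j _ → detℕ-equalRows-at d r K (minor F j) lt (λ k → e (punchInℕ j k)))

  detℕ-equalRows : ∀ r k K (F : Matrix) → r ≢ k → r < K → k < K → (∀ j → F r j ≈ F k j) → detℕ K F ≈ 0#
  detℕ-equalRows r k K F r≢k r<K k<K e with ℕ.<-cmp r k
  ... | tri≈ _ r≡k _ = ⊥-elim (r≢k r≡k)
  ... | tri< r<k _ _ with ℕ.m≤n⇒∃[o]m+o≡n r<k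
  ...   | d , ≡.refl = detℕ-equalRows-at d r K F k<K e
  detℕ-equalRows r k K F r≢k r<K k<K e | tri> _ _ k<r with ℕ.m≤n⇒∃[o]m+o≡n k<r
  ...   | d , ≡.refl = detℕ-equalRows-at d k K F r<K (λ j → sym (e j))

  detℕ-linearInRow : ∀ r K (E X Y : Matrix) a → r < K →
    (∀ i j → i < K → j < K → i ≢ r → E i j ≈ X i j) →
    (∀ i j → i < K → j < K → i ≢ r → E i j ≈ Y i j) →
    (∀ j → j < K → E r j ≈ X r j + a * Y r j) →
    detℕ K E ≈ detℕ K X + a * detℕ K Y
  detℕ-linearInRow zero (suc K) E X Y a _ E≈X E≈Y Eᵣ = detℕ-linear-viaMinors K E X Y a term
    where
    minorX : ∀ j → j < suc K → detℕ K (minor E j) ≈ detℕ K (minor X j)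
    minorX j j< = detℕ-cong K (λ i k i< k< → E≈X (suc i) (punchInℕ j k) (s≤s i<) (punchInℕ-< j k k<) λ ())
    minorY : ∀ j → j < suc K → detℕ K (minor E j) ≈ detℕ K (minor Y j)
    minorY j j< = detℕ-cong K (λ i k i< k< → E≈Y (suc i) (punchInℕ j k) (s≤s i<) (punchInℕ-< j k k<) λ ())
    term : ∀ j → j < suc K → E 0 j * detℕ K (minor E j) ≈ X 0 j * detℕ K (minor X j) + a * (Y 0 j * detℕ K (minor Y j))
    term j j< = begin
      E 0 j * detℕ K (minor E j)                                     ≈⟨ *-congʳ (Eᵣ j j<) ⟩
      (X 0 j + a * Y 0 j) * detℕ K (minor E j)                       ≈⟨ distribʳ _ _ _ ⟩
      X 0 j * detℕ K (minor E j) + (a * Y 0 j) * detℕ K (minor E j)  ≈⟨ +-cong (*-congˡ (minorX j j<))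
                                                                          (trans (*-assoc _ _ _) (*-congˡ (*-congˡ (minorY j j<)))) ⟩
      X 0 j * detℕ K (minor X j) + a * (Y 0 j * detℕ K (minor Y j))  ∎
  detℕ-linearInRow (suc r) (suc K) E X Y a (s≤s r<K) E≈X E≈Y Eᵣ = detℕ-linear-viaMinors K E X Y a term
    where
    off : ∀ {i} → i ≢ r → suc i ≢ suc r
    off i≢r ≡.refl = i≢r ≡.refl
    minorLinear : ∀ j → j < suc K → detℕ K (minor E j) ≈ detℕ K (minor X j) + a * detℕ K (minor Y j)
    minorLinear j j< = detℕ-linearInRow r K (minor E j) (minor X j) (minor Y j) a r<K
      (λ i k i< k< i≢r → E≈X (suc i) (punchInℕ j k) (s≤s i<) (punchInℕ-< j k k<) (off i≢r))
      (λ i k i< k< i≢r → E≈Y (suc i) (punchInℕ j k) (s≤s i<) (punchInℕ-< j k k<) (off i≢r))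
      (λ k k< → Eᵣ (punchInℕ j k) (punchInℕ-< j k k<))
    term : ∀ j → j < suc K → E 0 j * detℕ K (minor E j) ≈ X 0 j * detℕ K (minor X j) + a * (Y 0 j * detℕ K (minor Y j))
    term j j< = begin
      E 0 j * detℕ K (minor E j)                                          ≈⟨ *-congˡ (minorLinear j j<) ⟩
      E 0 j * (detℕ K (minor X j) + a * detℕ K (minor Y j))               ≈⟨ distribˡ _ _ _ ⟩
      E 0 j * detℕ K (minor X j) + E 0 j * (a * detℕ K (minor Y j))       ≈⟨ +-cong (*-congʳ (E≈X 0 j (s≤s z≤n) j< λ ()))
                                                                              (trans (*-left-comm _ _ _) (*-congˡ (*-congʳ (E≈Y 0 j (s≤s z≤n) j< λ ())))) ⟩
      X 0 j * detℕ K (minor X j) + a * (Y 0 j * detℕ K (minor Y j))       ∎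

  -- Y is G with row r replaced by row k, so that det Y vanishes.
  detℕ-addRowMultiple : ∀ r k K (E G : Matrix) a → r < K → k < K → r ≢ k →
    (∀ i j → i < K → j < K → i ≢ r → E i j ≈ G i j) →
    (∀ j → j < K → E r j ≈ G r j + a * G k j) →
    detℕ K E ≈ detℕ K G
  detℕ-addRowMultiple r k K E G a r<K k<K r≢k E≈G Eᵣ = begin
    detℕ K E                  ≈⟨ detℕ-linearInRow r K E G Y a r<K E≈G E≈Y Eᵣ′ ⟩
    detℕ K G + a * detℕ K Y   ≈⟨ +-congˡ (trans (*-congˡ (detℕ-equalRows r k K Y r≢k r<K k<K Yᵣ≈Yₖ)) (zeroʳ a)) ⟩
    detℕ K G + 0#             ≈⟨ +-identityʳ _ ⟩
    detℕ K G                  ∎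
    where
    Y : Matrix
    Y i j with i ℕ.≟ r
    ... | yes _ = G k j
    ... | no  _ = G i j
    Y-off : ∀ i j → i ≢ r → Y i j ≈ G i j
    Y-off i j i≢r with i ℕ.≟ r
    ... | yes i≡r = ⊥-elim (i≢r i≡r)
    ... | no  _   = refl
    Yᵣ : ∀ j → Y r j ≈ G k j
    Yᵣ j with r ℕ.≟ r
    ... | yes _   = refl
    ... | no  r≢r = ⊥-elim (r≢r ≡.refl)
    E≈Y : ∀ i j → i < K → j < K → i ≢ r → E i j ≈ Y i j
    E≈Y i j i< j< i≢r = trans (E≈G i j i< j< i≢r) (sym (Y-off i j i≢r))
    Eᵣ′ : ∀ j → j < K → E r j ≈ G r j + a * Y r j
    Eᵣ′ j j< = trans (Eᵣ j j<) (+-congˡ (*-congˡ (sym (Yᵣ j))))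
    Yᵣ≈Yₖ : ∀ j → Y r j ≈ Y k j
    Yᵣ≈Yₖ j = trans (Yᵣ j) (sym (Y-off k j (λ k≡r → r≢k (≡.sym k≡r))))

  -- The selected rows are modified one at a time, which is a single row operation each time
  -- because a source row π i is never itself modified.
  module _ (K : ℕ) (G : Matrix) (selected : ℕ → Bool) (π : ℕ → ℕ) (a : ℕ → Carrier)
           (source : ∀ i → i < K → selected i ≡ true → π i < K × selected (π i) ≡ false) where

    private
      partial : ℕ → Matrix
      partial t i j with i ℕ.<? t | selected i
      ... | yes _ | true  = G i j + a i * G (π i) j
      ... | yes _ | false = G i j
      ... | no  _ | _     = G i j

      partial-modified : ∀ t i j → i < t → selected i ≡ true → partial t i j ≈ G i j + a i * G (π i) j
      partial-modified t i j i<t sel with i ℕ.<? t | selected i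
      ... | yes _   | true  = refl
      ... | no  i≮t | _     = ⊥-elim (i≮t i<t)
      partial-modified t i j i<t () | yes _ | false

      partial-unmodified : ∀ t i j → (¬ i < t) → partial t i j ≈ G i j
      partial-unmodified t i j i≮t with i ℕ.<? t | selected i
      ... | yes i<t | _ = ⊥-elim (i≮t i<t)
      ... | no  _   | _ = refl

      partial-unselected : ∀ t i j → selected i ≡ false → partial t i j ≈ G i j
      partial-unselected t i j unsel with i ℕ.<? t | selected i
      ... | yes _ | false = refl
      ... | no  _ | _     = refl
      partial-unselected t i j () | yes _ | true

      partial-suc : ∀ t i j → i ≢ t → partial (suc t) i j ≈ partial t i j
      partial-suc t i j i≢t with i ℕ.<? suc t | i ℕ.<? t | selected i
      ... | yes _         | yes _   | true  = refl
      ... | yes _         | yes _   | false = refl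
      ... | no  _         | no  _   | _     = refl
      ... | yes _         | no  _   | false = refl
      ... | no  _         | yes _   | false = refl
      ... | yes (s≤s i≤t) | no  i≮t | true  = ⊥-elim (i≮t (ℕ.≤∧≢⇒< i≤t i≢t))
      ... | no  i≮t+1     | yes i<t | true  = ⊥-elim (i≮t+1 (ℕ.<-trans i<t (ℕ.n<1+n t)))

      detℕ-partial-suc : ∀ t → t < K → detℕ K (partial (suc t)) ≈ detℕ K (partial t)
      detℕ-partial-suc t t<K with selected t in sel
      ... | false = detℕ-cong K (λ i j _ _ → sameRows i j)
        where
        sameRows : ∀ i j → partial (suc t) i j ≈ partial t i j
        sameRows i j with i ℕ.≟ t
        ... | no  i≢t    = partial-suc t i j i≢t
        ... | yes ≡.refl = trans (partial-unselected (suc t) i j sel) (sym (partial-unselected t i j sel))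
      ... | true = detℕ-addRowMultiple t (π t) K (partial (suc t)) (partial t) (a t) t<K (proj₁ (source t t<K sel)) t≢πt
          (λ i j _ _ i≢t → partial-suc t i j i≢t)
          (λ j _ → trans (partial-modified (suc t) t j (ℕ.n<1+n t) sel)
                         (+-cong (sym (partial-unmodified t t j (ℕ.<-irrefl ≡.refl)))
                                 (*-congˡ (sym (partial-unselected t (π t) j (proj₂ (source t t<K sel)))))))
        where
        t≢πt : t ≢ π t
        t≢πt t≡πt with ≡.trans (≡.sym sel) (≡.trans (≡.cong selected t≡πt) (proj₂ (source t t<K sel)))
        ... | ()

      detℕ-partial : ∀ t → t ≤ K → detℕ K (partial t) ≈ detℕ K G
      detℕ-partial zero    _   = detℕ-cong K (λ i j _ _ → partial-unmodified 0 i j λ ())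
      detℕ-partial (suc t) t<K = trans (detℕ-partial-suc t t<K) (detℕ-partial t (ℕ.<⇒≤ t<K))

    detℕ-addRowMultiples : (E : Matrix) →
      (∀ i j → i < K → j < K → selected i ≡ true → E i j ≈ G i j + a i * G (π i) j) →
      (∀ i j → i < K → j < K → selected i ≡ false → E i j ≈ G i j) →
      detℕ K E ≈ detℕ K G
    detℕ-addRowMultiples E modified unmodified = trans (detℕ-cong K E≈partial) (detℕ-partial K ℕ.≤-refl)
      where
      E≈partial : ∀ i j → i < K → j < K → E i j ≈ partial K i j
      E≈partial i j i<K j<K = bySelection (selected i) ≡.refl
        where
        bySelection : ∀ b → selected i ≡ b → E i j ≈ partial K i j
        bySelection true  sel = trans (modified i j i<K j<K sel) (sym (partial-modified K i j i<K sel))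
        bySelection false sel = trans (unmodified i j i<K j<K sel) (sym (partial-unselected K i j sel))

  detℕ-blockLowerTriangular : ∀ N M (F : Matrix) → (∀ i j → i < N → N ≤ j → j < N ℕ.+ M → F i j ≈ 0#) →
    detℕ (N ℕ.+ M) F ≈ detℕ N F * detℕ M (λ i j → F (N ℕ.+ i) (N ℕ.+ j))
  detℕ-blockLowerTriangular zero    M F zeros = sym (*-identityˡ _)
  detℕ-blockLowerTriangular (suc N) M F zeros = begin
    sumTo (suc N ℕ.+ M) term
      ≈⟨ sumTo-+ (suc N) M term ⟩
    sumTo (suc N) term + sumTo M (λ j → term (suc N ℕ.+ j))
      ≈⟨ +-congˡ (sumTo-zero M (λ j j< → trans (signed-cong (suc N ℕ.+ j)
           (trans (*-congʳ (zeros 0 (suc N ℕ.+ j) (s≤s z≤n) (ℕ.m≤m+n (suc N) j) (ℕ.+-monoʳ-< (suc N) j<))) (zeroˡ _)))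
           (signed-0 (suc N ℕ.+ j)))) ⟩
    sumTo (suc N) term + 0#
      ≈⟨ +-identityʳ _ ⟩
    sumTo (suc N) term
      ≈⟨ sumTo-cong (suc N) factorTerm ⟩
    sumTo (suc N) (λ j → signed j (F 0 j * detℕ N (minor F j)) * lowerRight)
      ≈⟨ sym (*-distribʳ-sumTo (suc N) lowerRight (λ j → signed j (F 0 j * detℕ N (minor F j)))) ⟩
    detℕ (suc N) F * lowerRight ∎
    where
    term : ℕ → Carrier
    term j = signed j (F 0 j * detℕ (N ℕ.+ M) (minor F j))
    lowerRight : Carrier
    lowerRight = detℕ M (λ i j → F (suc N ℕ.+ i) (suc N ℕ.+ j))
    minorBlocks : ∀ j → j ≤ N → detℕ (N ℕ.+ M) (minor F j) ≈ detℕ N (minor F j) * lowerRight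
    minorBlocks j j≤N = trans
      (detℕ-blockLowerTriangular N M (minor F j) (λ i k i< N≤k k< →
        trans (reflexive (≡.cong (F (suc i)) (punchInℕ-≥ j k (ℕ.≤-trans j≤N N≤k))))
              (zeros (suc i) (suc k) (s≤s i<) (s≤s N≤k) (s≤s k<))))
      (*-congˡ (detℕ-cong M (λ a b _ _ →
        reflexive (≡.cong (F (suc (N ℕ.+ a))) (punchInℕ-≥ j (N ℕ.+ b) (ℕ.≤-trans j≤N (ℕ.m≤m+n N b)))))))
    factorTerm : ∀ j → j < suc N → term j ≈ signed j (F 0 j * detℕ N (minor F j)) * lowerRight
    factorTerm j (s≤s j≤N) = trans (signed-cong j (trans (*-congˡ (minorBlocks j j≤N)) (sym (*-assoc _ _ _))))
                                   (signed-*ʳ j _ lowerRight)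

  detℕ-blockUpperTriangular : ∀ N M (F : Matrix) → (∀ i j → N ≤ i → i < N ℕ.+ M → j < N → F i j ≈ 0#) →
    detℕ (N ℕ.+ M) F ≈ detℕ N F * detℕ M (λ i j → F (N ℕ.+ i) (N ℕ.+ j))
  detℕ-blockUpperTriangular N M F zeros = begin
    detℕ (N ℕ.+ M) F
      ≈⟨ sym (detℕ-transpose (N ℕ.+ M) F) ⟩
    detℕ (N ℕ.+ M) (transpose F)
      ≈⟨ detℕ-blockLowerTriangular N M (transpose F) (λ i j i< N≤j j< → zeros j i N≤j j< i<) ⟩
    detℕ N (transpose F) * detℕ M (λ i j → F (N ℕ.+ j) (N ℕ.+ i))
      ≈⟨ *-cong (detℕ-transpose N F) (detℕ-transpose M (λ i j → F (N ℕ.+ i) (N ℕ.+ j))) ⟩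
    detℕ N F * detℕ M (λ i j → F (N ℕ.+ i) (N ℕ.+ j)) ∎

  -- F (rotate p L i) j moves row p of F to position p + L and rows p + 1, …, p + L up by one
  rotate : ℕ → ℕ → ℕ → ℕ
  rotate (suc p) L       zero    = zero
  rotate (suc p) L       (suc i) = suc (rotate p L i)
  rotate zero    zero    i       = i
  rotate zero    (suc L) zero    = suc zero
  rotate zero    (suc L) (suc i) = swap₀₁ (suc (rotate zero L i))

  rotate-< : ∀ p L i → i < p → rotate p L i ≡ i
  rotate-< (suc p) L zero    _         = ≡.refl
  rotate-< (suc p) L (suc i) (s≤s i<p) = ≡.cong suc (rotate-< p L i i<p)

  rotate-inside : ∀ p L i → p ≤ i → i < p ℕ.+ L → rotate p L i ≡ suc i
  rotate-inside (suc p) L       (suc i) (s≤s p≤i) (s≤s i<) = ≡.cong suc (rotate-inside p L i p≤i i<)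
  rotate-inside zero    (suc L) zero    _         _        = ≡.refl
  rotate-inside zero    (suc L) (suc i) _         (s≤s i<) rewrite rotate-inside zero L i z≤n i< = ≡.refl

  rotate-last : ∀ p L → rotate p L (p ℕ.+ L) ≡ p
  rotate-last (suc p) L       = ≡.cong suc (rotate-last p L)
  rotate-last zero    zero    = ≡.refl
  rotate-last zero    (suc L) rewrite rotate-last zero L = ≡.refl

  rotate-> : ∀ p L i → p ℕ.+ L < i → rotate p L i ≡ i
  rotate-> (suc p) L       (suc i)       (s≤s <i) = ≡.cong suc (rotate-> p L i <i)
  rotate-> zero    zero    i             _        = ≡.refl
  rotate-> zero    (suc L) (suc (suc i)) (s≤s <i) rewrite rotate-> zero L (suc i) <i = ≡.refl

  detℕ-rotateRows : ∀ L p K (F : Matrix) → p ℕ.+ L < K → detℕ K (λ i j → F (rotate p L i) j) ≈ signed L (detℕ K F)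
  detℕ-rotateRows L (suc p) (suc K) F (s≤s lt) = trans
    (sumTo-cong (suc K) (λ j _ → trans (signed-cong j (trans (*-congˡ {F 0 j} (detℕ-rotateRows L p K (minor F j) lt))
                                                             (sym (signed-*ˡ L _ _))))
                                       (signed-comm j L _)))
    (sym (signed-sumTo L (suc K) (λ j → signed j (F 0 j * detℕ K (minor F j)))))
  detℕ-rotateRows zero    zero K             F _  = refl
  detℕ-rotateRows (suc L) zero (suc zero)    F (s≤s ())
  detℕ-rotateRows (suc L) zero (suc (suc K)) F lt = begin
    detℕ (suc (suc K)) (λ i j → F (rotate zero (suc L) i) j)  ≈⟨ detℕ-cong (suc (suc K)) (λ i j _ _ → unfold i j) ⟩
    detℕ (suc (suc K)) (λ i j → F (swap₀₁ (rotate 1 L i)) j) ≈⟨ detℕ-rotateRows L 1 (suc (suc K)) (λ i j → F (swap₀₁ i) j) lt ⟩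
    signed L (detℕ (suc (suc K)) (λ i j → F (swap₀₁ i) j))    ≈⟨ signed-cong L (detℕ-swapRows₀₁ K F) ⟩
    signed L (- detℕ (suc (suc K)) F)                         ≈⟨ signed-neg L _ ⟩
    signed (suc L) (detℕ (suc (suc K)) F)                     ∎
    where
    unfold : ∀ i j → F (rotate zero (suc L) i) j ≈ F (swap₀₁ (rotate 1 L i)) j
    unfold zero    j = refl
    unfold (suc i) j = refl

  detℕ-rotateColumns : ∀ L K (F : Matrix) → L < K → detℕ K (λ i j → F i (rotate 0 L j)) ≈ signed L (detℕ K F)
  detℕ-rotateColumns L K F L<K = trans (detℕ-transpose K (λ i j → F j (rotate 0 L i)))
    (trans (detℕ-rotateRows L 0 K (transpose F) L<K) (signed-cong L (detℕ-transpose K F)))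

  -- Block matrices

  block : ℕ → (A B C D : Matrix) → Matrix
  block N A B C D i j with i ℕ.<? N | j ℕ.<? N
  ... | yes _ | yes _ = A i j
  ... | yes _ | no  _ = B i (j ℕ.∸ N)
  ... | no  _ | yes _ = C (i ℕ.∸ N) j
  ... | no  _ | no  _ = D (i ℕ.∸ N) (j ℕ.∸ N)

  data Half (N : ℕ) : ℕ → Set where
    upper : ∀ {i} → i < N → Half N i
    lower : ∀ k → Half N (N ℕ.+ k)

  half : ∀ N i → Half N i
  half N i with i ℕ.<? N
  ... | yes i<N = upper i<N
  ... | no  i≮N with lower {N} (i ℕ.∸ N)
  ...   | h rewrite ℕ.m+[n∸m]≡n (ℕ.≮⇒≥ i≮N) = h

  isLower : ℕ → ℕ → Bool
  isLower N i with i ℕ.<? N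
  ... | yes _ = false
  ... | no  _ = true

  isLower-upper : ∀ N {i} → i < N → isLower N i ≡ false
  isLower-upper N {i} i<N with i ℕ.<? N
  ... | yes _   = ≡.refl
  ... | no  i≮N = ⊥-elim (i≮N i<N)

  isLower-lower : ∀ N k → isLower N (N ℕ.+ k) ≡ true
  isLower-lower N k with N ℕ.+ k ℕ.<? N
  ... | yes N+k<N = ⊥-elim (ℕ.m+n≮m N k N+k<N)
  ... | no  _     = ≡.refl

  module Block (N : ℕ) (A B C D : Matrix) where
    upperLeft : ∀ {i j} → i < N → j < N → block N A B C D i j ≈ A i j
    upperLeft {i} {j} i<N j<N with i ℕ.<? N | j ℕ.<? N
    ... | yes _   | yes _   = refl
    ... | no  i≮N | _       = ⊥-elim (i≮N i<N)
    ... | yes _   | no  j≮N = ⊥-elim (j≮N j<N)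

    upperRight : ∀ {i} l → i < N → block N A B C D i (N ℕ.+ l) ≈ B i l
    upperRight {i} l i<N with i ℕ.<? N | N ℕ.+ l ℕ.<? N
    ... | yes _   | no  _     = reflexive (≡.cong (B i) (ℕ.m+n∸m≡n N l))
    ... | no  i≮N | _         = ⊥-elim (i≮N i<N)
    ... | yes _   | yes N+l<N = ⊥-elim (ℕ.m+n≮m N l N+l<N)

    lowerLeft : ∀ k {j} → j < N → block N A B C D (N ℕ.+ k) j ≈ C k j
    lowerLeft k {j} j<N with N ℕ.+ k ℕ.<? N | j ℕ.<? N
    ... | no  _     | yes _   = reflexive (≡.cong (λ z → C z j) (ℕ.m+n∸m≡n N k))
    ... | yes N+k<N | _       = ⊥-elim (ℕ.m+n≮m N k N+k<N)
    ... | no  _     | no  j≮N = ⊥-elim (j≮N j<N)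

    lowerRight : ∀ k l → block N A B C D (N ℕ.+ k) (N ℕ.+ l) ≈ D k l
    lowerRight k l with N ℕ.+ k ℕ.<? N | N ℕ.+ l ℕ.<? N
    ... | no  _     | no  _     = reflexive (≡.cong₂ D (ℕ.m+n∸m≡n N k) (ℕ.m+n∸m≡n N l))
    ... | yes N+k<N | _         = ⊥-elim (ℕ.m+n≮m N k N+k<N)
    ... | no  _     | yes N+l<N = ⊥-elim (ℕ.m+n≮m N l N+l<N)

  byBlocks : ∀ {p} N M (P : ℕ → ℕ → Set p) →
    (∀ i j → i < N → j < N → P i j) → (∀ i l → i < N → l < M → P i (N ℕ.+ l)) →
    (∀ k j → k < M → j < N → P (N ℕ.+ k) j) → (∀ k l → k < M → l < M → P (N ℕ.+ k) (N ℕ.+ l)) →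
    ∀ i j → i < N ℕ.+ M → j < N ℕ.+ M → P i j
  byBlocks N M P ul ur ll lr i j i< j< with half N i | half N j
  ... | upper i<N | upper j<N = ul i j i<N j<N
  ... | upper i<N | lower l   = ur i l i<N (ℕ.+-cancelˡ-< N l M j<)
  ... | lower k   | upper j<N = ll k j (ℕ.+-cancelˡ-< N k M i<) j<N
  ... | lower k   | lower l   = lr k l (ℕ.+-cancelˡ-< N k M i<) (ℕ.+-cancelˡ-< N l M j<)

  detℕ-block-cong : ∀ N M {A B C D A′ B′ C′ D′ : Matrix} →
    (∀ i j → i < N → j < N → A i j ≈ A′ i j) → (∀ i l → i < N → l < M → B i l ≈ B′ i l) →
    (∀ k j → k < M → j < N → C k j ≈ C′ k j) → (∀ k l → k < M → l < M → D k l ≈ D′ k l) →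
    detℕ (N ℕ.+ M) (block N A B C D) ≈ detℕ (N ℕ.+ M) (block N A′ B′ C′ D′)
  detℕ-block-cong N M {A} {B} {C} {D} {A′} {B′} {C′} {D′} A≈ B≈ C≈ D≈ = detℕ-cong (N ℕ.+ M) (byBlocks N M _
    (λ i j i< j< → trans (G.upperLeft i< j<) (trans (A≈ i j i< j<) (sym (G′.upperLeft i< j<))))
    (λ i l i< l< → trans (G.upperRight l i<) (trans (B≈ i l i< l<) (sym (G′.upperRight l i<))))
    (λ k j k< j< → trans (G.lowerLeft k j<) (trans (C≈ k j k< j<) (sym (G′.lowerLeft k j<))))
    (λ k l k< l< → trans (G.lowerRight k l) (trans (D≈ k l k< l<) (sym (G′.lowerRight k l)))))
    where
    module G  = Block N A B C D
    module G′ = Block N A′ B′ C′ D′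

  detℕ-block-transpose : ∀ N M (A B C D : Matrix) →
    detℕ (N ℕ.+ M) (block N (transpose A) (transpose C) (transpose B) (transpose D)) ≈ detℕ (N ℕ.+ M) (block N A B C D)
  detℕ-block-transpose N M A B C D = trans (detℕ-cong (N ℕ.+ M) (byBlocks N M _
      (λ i j i< j< → trans (Gᵀ.upperLeft i< j<) (sym (G.upperLeft j< i<)))
      (λ i l i< _ → trans (Gᵀ.upperRight l i<) (sym (G.lowerLeft l i<)))
      (λ k j _ j< → trans (Gᵀ.lowerLeft k j<) (sym (G.upperRight k j<)))
      (λ k l _ _ → trans (Gᵀ.lowerRight k l) (sym (G.lowerRight l k)))))
    (detℕ-transpose (N ℕ.+ M) (block N A B C D))
    where
    module G  = Block N A B C D
    module Gᵀ = Block N (transpose A) (transpose C) (transpose B) (transpose D)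

  isLower-upper-≢ : ∀ N {i} → i < N → isLower N i ≢ true
  isLower-upper-≢ N i<N e with ≡.trans (≡.sym (isLower-upper N i<N)) e
  ... | ()

  isLower-lower-≢ : ∀ N k → isLower N (N ℕ.+ k) ≢ false
  isLower-lower-≢ N k e with ≡.trans (≡.sym (isLower-lower N k)) e
  ... | ()

  isUpper : ℕ → ℕ → Bool
  isUpper N i = not (isLower N i)

  isUpper-upper : ∀ N {i} → i < N → isUpper N i ≡ true
  isUpper-upper N i<N = ≡.cong not (isLower-upper N i<N)

  isUpper-lower : ∀ N k → isUpper N (N ℕ.+ k) ≡ false
  isUpper-lower N k = ≡.cong not (isLower-lower N k)

  isUpper-upper-≢ : ∀ N {i} → i < N → isUpper N i ≢ false
  isUpper-upper-≢ N i<N e with ≡.trans (≡.sym (isUpper-upper N i<N)) e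
  ... | ()

  isUpper-lower-≢ : ∀ N k → isUpper N (N ℕ.+ k) ≢ true
  isUpper-lower-≢ N k e with ≡.trans (≡.sym (isUpper-lower N k)) e
  ... | ()

  module _ (N M : ℕ) (A B C D : Matrix) where
    private
      module G = Block N A B C D

    detℕ-block-addToLowerRows : (C′ D′ : Matrix) (σ : ℕ → ℕ) (a : ℕ → Carrier) → (∀ k → k < M → σ k < N) →
      (∀ k j → k < M → j < N → C′ k j ≈ C k j + a k * A (σ k) j) →
      (∀ k l → k < M → l < M → D′ k l ≈ D k l + a k * B (σ k) l) →
      detℕ (N ℕ.+ M) (block N A B C′ D′) ≈ detℕ (N ℕ.+ M) (block N A B C D)
    detℕ-block-addToLowerRows C′ D′ σ a σ< C′≈ D′≈ =
      detℕ-addRowMultiples (N ℕ.+ M) (block N A B C D) (isLower N) (λ i → σ (i ℕ.∸ N)) (λ i → a (i ℕ.∸ N)) source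
        (block N A B C′ D′)
        (byBlocks N M _ (λ i j i< _ sel → ⊥-elim (isLower-upper-≢ N i< sel))
                        (λ i l i< _ sel → ⊥-elim (isLower-upper-≢ N i< sel)) lowerLeft lowerRight)
        (byBlocks N M _ (λ i j i< j< _ → trans (G′.upperLeft i< j<) (sym (G.upperLeft i< j<)))
                        (λ i l i< _ _ → trans (G′.upperRight l i<) (sym (G.upperRight l i<)))
                        (λ k j _ _ unsel → ⊥-elim (isLower-lower-≢ N k unsel))
                        (λ k l _ _ unsel → ⊥-elim (isLower-lower-≢ N k unsel)))
      where
      module G′ = Block N A B C′ D′
      source : ∀ i → i < N ℕ.+ M → isLower N i ≡ true → σ (i ℕ.∸ N) < N ℕ.+ M × isLower N (σ (i ℕ.∸ N)) ≡ false
      source i i< sel with half N i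
      ... | upper i<N = ⊥-elim (isLower-upper-≢ N i<N sel)
      ... | lower k rewrite ℕ.m+n∸m≡n N k =
        let σk<N = σ< k (ℕ.+-cancelˡ-< N k M i<) in ℕ.<-≤-trans σk<N (ℕ.m≤m+n N M) , isLower-upper N σk<N
      lowerLeft : ∀ k j → k < M → j < N → isLower N (N ℕ.+ k) ≡ true →
        block N A B C′ D′ (N ℕ.+ k) j ≈ block N A B C D (N ℕ.+ k) j + a (N ℕ.+ k ℕ.∸ N) * block N A B C D (σ (N ℕ.+ k ℕ.∸ N)) j
      lowerLeft k j k< j< _ rewrite ℕ.m+n∸m≡n N k =
        trans (G′.lowerLeft k j<) (trans (C′≈ k j k< j<) (sym (+-cong (G.lowerLeft k j<) (*-congˡ (G.upperLeft (σ< k k<) j<)))))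
      lowerRight : ∀ k l → k < M → l < M → isLower N (N ℕ.+ k) ≡ true →
        block N A B C′ D′ (N ℕ.+ k) (N ℕ.+ l) ≈ block N A B C D (N ℕ.+ k) (N ℕ.+ l) + a (N ℕ.+ k ℕ.∸ N) * block N A B C D (σ (N ℕ.+ k ℕ.∸ N)) (N ℕ.+ l)
      lowerRight k l k< l< _ rewrite ℕ.m+n∸m≡n N k =
        trans (G′.lowerRight k l) (trans (D′≈ k l k< l<) (sym (+-cong (G.lowerRight k l) (*-congˡ (G.upperRight l (σ< k k<))))))

    detℕ-block-addToUpperRows : (A′ B′ : Matrix) (σ : ℕ → ℕ) (a : ℕ → Carrier) → (∀ i → i < N → σ i < M) →
      (∀ i j → i < N → j < N → A′ i j ≈ A i j + a i * C (σ i) j) →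
      (∀ i l → i < N → l < M → B′ i l ≈ B i l + a i * D (σ i) l) →
      detℕ (N ℕ.+ M) (block N A′ B′ C D) ≈ detℕ (N ℕ.+ M) (block N A B C D)
    detℕ-block-addToUpperRows A′ B′ σ a σ< A′≈ B′≈ =
      detℕ-addRowMultiples (N ℕ.+ M) (block N A B C D) (isUpper N) (λ i → N ℕ.+ σ i) a source
        (block N A′ B′ C D)
        (byBlocks N M _
          (λ i j i< j< _ → trans (G′.upperLeft i< j<) (trans (A′≈ i j i< j<)
                             (sym (+-cong (G.upperLeft i< j<) (*-congˡ (G.lowerLeft (σ i) j<))))))
          (λ i l i< l< _ → trans (G′.upperRight l i<) (trans (B′≈ i l i< l<)
                             (sym (+-cong (G.upperRight l i<) (*-congˡ (G.lowerRight (σ i) l))))))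
          (λ k j _ _ sel → ⊥-elim (isUpper-lower-≢ N k sel))
          (λ k l _ _ sel → ⊥-elim (isUpper-lower-≢ N k sel)))
        (byBlocks N M _
          (λ i j i< _ unsel → ⊥-elim (isUpper-upper-≢ N i< unsel))
          (λ i l i< _ unsel → ⊥-elim (isUpper-upper-≢ N i< unsel))
          (λ k j _ j< _ → trans (G′.lowerLeft k j<) (sym (G.lowerLeft k j<)))
          (λ k l _ _ _ → trans (G′.lowerRight k l) (sym (G.lowerRight k l))))
      where
      module G′ = Block N A′ B′ C D
      source : ∀ i → i < N ℕ.+ M → isUpper N i ≡ true → N ℕ.+ σ i < N ℕ.+ M × isUpper N (N ℕ.+ σ i) ≡ false
      source i i< sel with half N i
      ... | upper i<N = ℕ.+-monoʳ-< N (σ< i i<N) , isUpper-lower N (σ i)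
      ... | lower k   = ⊥-elim (isUpper-lower-≢ N k sel)

  detℕ-block-addToRightColumns : ∀ N M (A B C D B′ D′ : Matrix) (σ : ℕ → ℕ) (a : ℕ → Carrier) →
    (∀ l → l < M → σ l < N) →
    (∀ i l → i < N → l < M → B′ i l ≈ B i l + a l * A i (σ l)) →
    (∀ k l → k < M → l < M → D′ k l ≈ D k l + a l * C k (σ l)) →
    detℕ (N ℕ.+ M) (block N A B′ C D′) ≈ detℕ (N ℕ.+ M) (block N A B C D)
  detℕ-block-addToRightColumns N M A B C D B′ D′ σ a σ< B′≈ D′≈ = begin
    detℕ (N ℕ.+ M) (block N A B′ C D′)
      ≈⟨ sym (detℕ-block-transpose N M A B′ C D′) ⟩
    detℕ (N ℕ.+ M) (block N (transpose A) (transpose C) (transpose B′) (transpose D′))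
      ≈⟨ detℕ-block-addToLowerRows N M (transpose A) (transpose C) (transpose B) (transpose D) (transpose B′) (transpose D′)
           σ a σ< (λ l i l< i< → B′≈ i l i< l<) (λ l k l< k< → D′≈ k l k< l<) ⟩
    detℕ (N ℕ.+ M) (block N (transpose A) (transpose C) (transpose B) (transpose D))
      ≈⟨ detℕ-block-transpose N M A B C D ⟩
    detℕ (N ℕ.+ M) (block N A B C D) ∎

  detℕ-block-addToLeftColumns : ∀ N M (A B C D A′ C′ : Matrix) (σ : ℕ → ℕ) (a : ℕ → Carrier) →
    (∀ j → j < N → σ j < M) →
    (∀ i j → i < N → j < N → A′ i j ≈ A i j + a j * B i (σ j)) →
    (∀ k j → k < M → j < N → C′ k j ≈ C k j + a j * D k (σ j)) →
    detℕ (N ℕ.+ M) (block N A′ B C′ D) ≈ detℕ (N ℕ.+ M) (block N A B C D)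
  detℕ-block-addToLeftColumns N M A B C D A′ C′ σ a σ< A′≈ C′≈ = begin
    detℕ (N ℕ.+ M) (block N A′ B C′ D)
      ≈⟨ sym (detℕ-block-transpose N M A′ B C′ D) ⟩
    detℕ (N ℕ.+ M) (block N (transpose A′) (transpose C′) (transpose B) (transpose D))
      ≈⟨ detℕ-block-addToUpperRows N M (transpose A) (transpose C) (transpose B) (transpose D) (transpose A′) (transpose C′)
           σ a σ< (λ j i j< i< → A′≈ i j i< j<) (λ j k j< k< → C′≈ k j k< j<) ⟩
    detℕ (N ℕ.+ M) (block N (transpose A) (transpose C) (transpose B) (transpose D))
      ≈⟨ detℕ-block-transpose N M A B C D ⟩
    detℕ (N ℕ.+ M) (block N A B C D) ∎

  module _ (N M : ℕ) (A B C D : Matrix) where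
    private
      module G = Block N A B C D

      corners : detℕ N (block N A B C D) * detℕ M (λ k l → block N A B C D (N ℕ.+ k) (N ℕ.+ l)) ≈ detℕ N A * detℕ M D
      corners = *-cong (detℕ-cong N (λ i j i< j< → G.upperLeft i< j<)) (detℕ-cong M (λ k l _ _ → G.lowerRight k l))

    detℕ-block-lowerTriangular : (∀ i l → i < N → l < M → B i l ≈ 0#) →
                                 detℕ (N ℕ.+ M) (block N A B C D) ≈ detℕ N A * detℕ M D
    detℕ-block-lowerTriangular B≈0 = trans (detℕ-blockLowerTriangular N M (block N A B C D) zeros) corners
      where
      zeros : ∀ i j → i < N → N ≤ j → j < N ℕ.+ M → block N A B C D i j ≈ 0#
      zeros i j i<N N≤j j< with half N j
      ... | upper j<N = ⊥-elim (ℕ.<⇒≱ j<N N≤j)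
      ... | lower l   = trans (G.upperRight l i<N) (B≈0 i l i<N (ℕ.+-cancelˡ-< N l M j<))

    detℕ-block-upperTriangular : (∀ k j → k < M → j < N → C k j ≈ 0#) →
                                 detℕ (N ℕ.+ M) (block N A B C D) ≈ detℕ N A * detℕ M D
    detℕ-block-upperTriangular C≈0 = trans (detℕ-blockUpperTriangular N M (block N A B C D) zeros) corners
      where
      zeros : ∀ i j → N ≤ i → i < N ℕ.+ M → j < N → block N A B C D i j ≈ 0#
      zeros i j N≤i i< j<N with half N i
      ... | upper i<N = ⊥-elim (ℕ.<⇒≱ i<N N≤i)
      ... | lower k   = trans (G.lowerLeft k j<N) (C≈0 k j (ℕ.+-cancelˡ-< N k M i<) j<N)

  detℕ-block-clearLowerLeft : ∀ N M (A B C D : Matrix) (σ : ℕ → ℕ) (a : ℕ → Carrier) → (∀ j → j < N → σ j < M) →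
    (∀ k j → k < M → j < N → C k j + a j * D k (σ j) ≈ 0#) →
    detℕ (N ℕ.+ M) (block N A B C D) ≈ detℕ N (λ i j → A i j + a j * B i (σ j)) * detℕ M D
  detℕ-block-clearLowerLeft N M A B C D σ a σ< cleared = begin
    detℕ (N ℕ.+ M) (block N A B C D)
      ≈⟨ sym (detℕ-block-addToLeftColumns N M A B C D _ _ σ a σ< (λ _ _ _ _ → refl) (λ _ _ _ _ → refl)) ⟩
    detℕ (N ℕ.+ M) (block N (λ i j → A i j + a j * B i (σ j)) B (λ k j → C k j + a j * D k (σ j)) D)
      ≈⟨ detℕ-block-upperTriangular N M _ B _ D cleared ⟩
    detℕ N (λ i j → A i j + a j * B i (σ j)) * detℕ M D ∎

  detℕ-block-clearUpperRight : ∀ N M (A B C D : Matrix) (σ : ℕ → ℕ) (a : ℕ → Carrier) → (∀ l → l < M → σ l < N) →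
    (∀ i l → i < N → l < M → B i l + a l * A i (σ l) ≈ 0#) →
    detℕ (N ℕ.+ M) (block N A B C D) ≈ detℕ N A * detℕ M (λ k l → D k l + a l * C k (σ l))
  detℕ-block-clearUpperRight N M A B C D σ a σ< cleared = begin
    detℕ (N ℕ.+ M) (block N A B C D)
      ≈⟨ sym (detℕ-block-addToRightColumns N M A B C D _ _ σ a σ< (λ _ _ _ _ → refl) (λ _ _ _ _ → refl)) ⟩
    detℕ (N ℕ.+ M) (block N A (λ i l → B i l + a l * A i (σ l)) C (λ k l → D k l + a l * C k (σ l)))
      ≈⟨ detℕ-block-lowerTriangular N M A _ C _ cleared ⟩
    detℕ N A * detℕ M (λ k l → D k l + a l * C k (σ l)) ∎

  -- subtract the upper rows from the lower ones, then add the right columns to the left ones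
  detℕ-block-symmetric : ∀ N (P Q : Matrix) →
    detℕ (N ℕ.+ N) (block N P Q Q P) ≈ detℕ N (λ i j → P i j + Q i j) * detℕ N (λ i j → P i j - Q i j)
  detℕ-block-symmetric N P Q = begin
    detℕ (N ℕ.+ N) (block N P Q Q P)
      ≈⟨ sym (detℕ-block-addToLowerRows N N P Q Q P _ _ (λ k → k) (λ _ → - 1#) (λ _ k< → k<)
                (λ _ _ _ _ → refl) (λ _ _ _ _ → refl)) ⟩
    detℕ (N ℕ.+ N) (block N P Q (λ k j → Q k j + - 1# * P k j) (λ k l → P k l + - 1# * Q k l))
      ≈⟨ detℕ-block-clearLowerLeft N N P Q _ _ (λ j → j) (λ _ → 1#) (λ _ j< → j<) (λ k j _ _ → differences-cancel (P k j) (Q k j)) ⟩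
    detℕ N (λ i j → P i j + 1# * Q i j) * detℕ N (λ k l → P k l + - 1# * Q k l)
      ≈⟨ *-cong (detℕ-cong N (λ i j _ _ → +-congˡ (*-identityˡ (Q i j))))
                (detℕ-cong N (λ i j _ _ → +-congˡ (-1*x≈-x (Q i j)))) ⟩
    detℕ N (λ i j → P i j + Q i j) * detℕ N (λ i j → P i j - Q i j) ∎

module SymmetricFunctions {c ℓ : Level} (R : CommutativeRing c ℓ) (g : ℕ → CommutativeRing.Carrier R) where
  open CommutativeRing R hiding (zero)
  open Sym R g
  open Determinant R
  open RingProperties ring using (-1*x≈-x)
  open import Relation.Binary.Reasoning.Setoid setoid

  sgn≈signed : ∀ k x → sgn k x ≈ signed k x
  sgn≈signed zero    x = refl
  sgn≈signed (suc k) x = -‿cong (sgn≈signed k x)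

  sumFin≈sumTo : ∀ n (f : Fin n → Carrier) (f′ : ℕ → Carrier) → (∀ j → f j ≈ f′ (toℕ j)) → sumFin f ≈ sumTo n f′
  sumFin≈sumTo zero    f f′ e = refl
  sumFin≈sumTo (suc n) f f′ e = +-cong (e zero) (sumFin≈sumTo n _ _ (λ j → e (suc j)))

  toℕ-punchIn : ∀ {K} (j : Fin (suc K)) (k : Fin K) → toℕ (punchIn j k) ≡ punchInℕ (toℕ j) (toℕ k)
  toℕ-punchIn zero    k       = ≡.refl
  toℕ-punchIn (suc j) zero    = ≡.refl
  toℕ-punchIn (suc j) (suc k) = ≡.cong suc (toℕ-punchIn j k)

  det≈detℕ : ∀ K (E : Fin K → Fin K → Carrier) (F : Matrix) → (∀ a b → E a b ≈ F (toℕ a) (toℕ b)) → det E ≈ detℕ K F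
  det≈detℕ zero    E F e = refl
  det≈detℕ (suc K) E F e = sumFin≈sumTo (suc K) _ (λ j → signed j (F 0 j * detℕ K (minor F j))) (λ j →
    trans (sgn≈signed (toℕ j) _) (signed-cong (toℕ j) (*-cong (e zero j) (det≈detℕ K _ (minor F (toℕ j))
      (λ a b → trans (e (suc a) (punchIn j b)) (reflexive (≡.cong (F (suc (toℕ a))) (toℕ-punchIn j b))))))))

  -- For 0-based i, j: H α i j = h_{α_i - i + j} and H′ α i j = h_{α_i - i - j + 1} in 1-based indexing.
  H H′ Hᵒ spMatrix : (ℕ → ℤ) → Matrix
  H  α i j = h (α i ℤ.- + suc i ℤ.+ + suc j)
  H′ α i j = h (α i ℤ.- + suc i ℤ.- + suc j ℤ.+ + 1)
  Hᵒ α i j = h (α i ℤ.- + suc i ℤ.- + suc j)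
  spMatrix α i zero    = h (α i ℤ.- + suc i ℤ.+ + 1)
  spMatrix α i (suc j) = H α i (suc j) + h (α i ℤ.- + suc i ℤ.- + suc (suc j) ℤ.+ + 2)

  module _ {N : ℕ} {α : Fin N → ℤ} (αℕ : ℕ → ℤ) (α≡ : ∀ i → α i ≡ αℕ (toℕ i)) where
    private
      entry : (f : ℤ → Carrier) → ∀ i → f (α i) ≈ f (αℕ (toℕ i))
      entry f i = reflexive (≡.cong f (α≡ i))

    so≈detℕ : so α ≈ detℕ N (λ i j → H αℕ i j + H′ αℕ i j)
    so≈detℕ = det≈detℕ N _ _ (λ i j → entry (λ a → h (a ℤ.- ι i ℤ.+ ι j) + h (a ℤ.- ι i ℤ.- ι j ℤ.+ + 1)) i)

    so⁻≈detℕ : so⁻ α ≈ detℕ N (λ i j → H αℕ i j - H′ αℕ i j)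
    so⁻≈detℕ = det≈detℕ N _ _ (λ i j → entry (λ a → h (a ℤ.- ι i ℤ.+ ι j) - h (a ℤ.- ι i ℤ.- ι j ℤ.+ + 1)) i)

    o≈detℕ : o α ≈ detℕ N (λ i j → H αℕ i j - Hᵒ αℕ i j)
    o≈detℕ = det≈detℕ N _ _ (λ i j → entry (λ a → h (a ℤ.- ι i ℤ.+ ι j) - h (a ℤ.- ι i ℤ.- ι j)) i)

    sp≈detℕ : sp α ≈ detℕ N (spMatrix αℕ)
    sp≈detℕ = det≈detℕ N _ (spMatrix αℕ) spEntry
      where
      spEntry : ∀ i j → _ ≈ spMatrix αℕ (toℕ i) (toℕ j)
      spEntry i zero    = entry (λ a → h (a ℤ.- ι i ℤ.+ + 1)) i
      spEntry i (suc j) = entry (λ a → h (a ℤ.- ι i ℤ.+ ι (suc j)) + h (a ℤ.- ι i ℤ.- ι (suc j) ℤ.+ + 2)) i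

  module _ {N M : ℕ} {α : Fin N → ℤ} {β : Fin M → ℤ} (αℕ βℕ : ℕ → ℤ)
           (α≡ : ∀ i → α i ≡ αℕ (toℕ i)) (β≡ : ∀ i → β i ≡ βℕ (toℕ i)) where
    private
      module G = Block N (H αℕ) (H′ αℕ) (H′ βℕ) (H βℕ)
      toℕ-inj₁ : ∀ {a : Fin (N ℕ.+ M)} {i} → splitAt N a ≡ inj₁ i → toℕ a ≡ toℕ i
      toℕ-inj₁ {i = i} e = ≡.trans (≡.cong toℕ (≡.sym (Fin.splitAt⁻¹-↑ˡ e))) (Fin.toℕ-↑ˡ i M)
      toℕ-inj₂ : ∀ {a : Fin (N ℕ.+ M)} {k} → splitAt N a ≡ inj₂ k → toℕ a ≡ N ℕ.+ toℕ k
      toℕ-inj₂ {k = k} e = ≡.trans (≡.cong toℕ (≡.sym (Fin.splitAt⁻¹-↑ʳ e))) (Fin.toℕ-↑ʳ N k)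

    mutual
      rs≈detℕ : rs α β ≈ detℕ (N ℕ.+ M) (block N (H αℕ) (H′ αℕ) (H′ βℕ) (H βℕ))
      rs≈detℕ = det≈detℕ (N ℕ.+ M) _ _ rsEntry

      private
        rsEntry : ∀ a b → _ ≈ block N (H αℕ) (H′ αℕ) (H′ βℕ) (H βℕ) (toℕ a) (toℕ b)
        rsEntry a b with splitAt N a in ea | splitAt N b in eb
        ... | inj₁ i | inj₁ j rewrite toℕ-inj₁ ea | toℕ-inj₁ eb =
          trans (reflexive (≡.cong (λ z → h (z ℤ.- ι i ℤ.+ ι j)) (α≡ i))) (sym (G.upperLeft (Fin.toℕ<n i) (Fin.toℕ<n j)))
        ... | inj₁ i | inj₂ l rewrite toℕ-inj₁ ea | toℕ-inj₂ eb =
          trans (reflexive (≡.cong (λ z → h (z ℤ.- ι i ℤ.- ι l ℤ.+ + 1)) (α≡ i))) (sym (G.upperRight (toℕ l) (Fin.toℕ<n i)))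
        ... | inj₂ k | inj₁ j rewrite toℕ-inj₂ ea | toℕ-inj₁ eb =
          trans (reflexive (≡.cong (λ z → h (z ℤ.- ι k ℤ.- ι j ℤ.+ + 1)) (β≡ k))) (sym (G.lowerLeft (toℕ k) (Fin.toℕ<n j)))
        ... | inj₂ k | inj₂ l rewrite toℕ-inj₂ ea | toℕ-inj₂ eb =
          trans (reflexive (≡.cong (λ z → h (z ℤ.- ι k ℤ.+ ι l)) (β≡ k))) (sym (G.lowerRight (toℕ k) (toℕ l)))

  rs-diagonal : ∀ {N} (α : Fin N → ℤ) → rs α α ≈ so α * so⁻ α
  rs-diagonal {N} α = begin
    rs α α                                          ≈⟨ rs≈detℕ a a a≡ a≡ ⟩
    detℕ (N ℕ.+ N) (block N (H a) (H′ a) (H′ a) (H a)) ≈⟨ detℕ-block-symmetric N (H a) (H′ a) ⟩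
    detℕ N (λ i j → H a i j + H′ a i j) * detℕ N (λ i j → H a i j - H′ a i j)
                                                    ≈⟨ sym (*-cong (so≈detℕ a a≡) (so⁻≈detℕ a a≡)) ⟩
    so α * so⁻ α                                    ∎
    where
    a : ℕ → ℤ
    a = extend (+ 0) α
    a≡ : ∀ i → α i ≡ a (toℕ i)
    a≡ i = ≡.sym (extend-toℕ (+ 0) α i)

  _⁺ : (ℕ → ℤ) → ℕ → ℤ
  (a ⁺) k = a k ℤ.+ + 1

  module _ (a : ℕ → ℤ) (i : ℕ) where
    H-⁺ : ∀ l → H (a ⁺) i l ≈ H a i (suc l)
    H-⁺ l = reflexive (≡.cong h (shift (a i) (+ i) (+ l)))
      where
      shift : ∀ x i l → x ℤ.+ + 1 ℤ.- (+ 1 ℤ.+ i) ℤ.+ (+ 1 ℤ.+ l) ≡ x ℤ.- (+ 1 ℤ.+ i) ℤ.+ (+ 2 ℤ.+ l)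
      shift = solve-∀

    H′-⁺ : ∀ l → H′ (a ⁺) i (suc l) ≈ H′ a i l
    H′-⁺ l = reflexive (≡.cong h (shift (a i) (+ i) (+ l)))
      where
      shift : ∀ x i l → x ℤ.+ + 1 ℤ.- (+ 1 ℤ.+ i) ℤ.- (+ 2 ℤ.+ l) ℤ.+ + 1 ≡ x ℤ.- (+ 1 ℤ.+ i) ℤ.- (+ 1 ℤ.+ l) ℤ.+ + 1
      shift = solve-∀

    H′-⁺-0 : H′ (a ⁺) i 0 ≈ H a i 0
    H′-⁺-0 = reflexive (≡.cong h (shift (a i) (+ i)))
      where
      shift : ∀ x i → x ℤ.+ + 1 ℤ.- (+ 1 ℤ.+ i) ℤ.- + 1 ℤ.+ + 1 ≡ x ℤ.- (+ 1 ℤ.+ i) ℤ.+ + 1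
      shift = solve-∀

    Hᵒ-⁺ : ∀ j → Hᵒ (a ⁺) i j ≈ H′ a i j
    Hᵒ-⁺ j = reflexive (≡.cong h (shift (a i) (+ i) (+ j)))
      where
      shift : ∀ x i j → x ℤ.+ + 1 ℤ.- (+ 1 ℤ.+ i) ℤ.- (+ 1 ℤ.+ j) ≡ x ℤ.- (+ 1 ℤ.+ i) ℤ.- (+ 1 ℤ.+ j) ℤ.+ + 1
      shift = solve-∀

    spMatrix-suc : ∀ l → spMatrix a i (suc l) ≈ H a i (suc l) + H′ a i l
    spMatrix-suc l = +-congˡ (reflexive (≡.cong h (shift (a i) (+ i) (+ l))))
      where
      shift : ∀ x i l → x ℤ.- (+ 1 ℤ.+ i) ℤ.- (+ 2 ℤ.+ l) ℤ.+ + 2 ≡ x ℤ.- (+ 1 ℤ.+ i) ℤ.- (+ 1 ℤ.+ l) ℤ.+ + 1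
      shift = solve-∀

  -- subtract the lower rows from the upper ones, then add column l - 1 to column l on the right
  rs-shifted : ∀ {N} (α : Fin N → ℤ) → rs (λ i → α i ℤ.+ + 1) α ≈ o (λ i → α i ℤ.+ + 1) * sp α
  rs-shifted {N} α = begin
    rs (λ i → α i ℤ.+ + 1) α
      ≈⟨ rs≈detℕ (a ⁺) a (λ i → ≡.cong (ℤ._+ + 1) (a≡ i)) a≡ ⟩
    detℕ (N ℕ.+ N) (block N (H (a ⁺)) (H′ (a ⁺)) (H′ a) (H a))
      ≈⟨ sym (detℕ-block-addToUpperRows N N (H (a ⁺)) (H′ (a ⁺)) (H′ a) (H a) _ _ (λ i → i) (λ _ → - 1#) (λ _ i< → i<)
                (λ _ _ _ _ → refl) (λ _ _ _ _ → refl)) ⟩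
    detℕ (N ℕ.+ N) (block N A′ B′ (H′ a) (H a))
      ≈⟨ detℕ-block-clearUpperRight N N A′ B′ (H′ a) (H a) ℕ.pred [0<_] (λ l l< → ℕ.≤-<-trans ℕ.pred[n]≤n l<)
           (λ i l _ _ → cleared i l) ⟩
    detℕ N A′ * detℕ N (λ k l → H a k l + [0< l ] * H′ a k (ℕ.pred l))
      ≈⟨ *-cong (detℕ-cong N (λ i j _ _ → +-congˡ (trans (-1*x≈-x _) (-‿cong (sym (Hᵒ-⁺ a i j))))))
                (detℕ-cong N (λ k l _ _ → spColumn k l)) ⟩
    detℕ N (λ i j → H (a ⁺) i j - Hᵒ (a ⁺) i j) * detℕ N (spMatrix a)
      ≈⟨ sym (*-cong (o≈detℕ (a ⁺) (λ i → ≡.cong (ℤ._+ + 1) (a≡ i))) (sp≈detℕ a a≡)) ⟩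
    o (λ i → α i ℤ.+ + 1) * sp α ∎
    where
    a : ℕ → ℤ
    a = extend (+ 0) α
    a≡ : ∀ i → α i ≡ a (toℕ i)
    a≡ i = ≡.sym (extend-toℕ (+ 0) α i)
    A′ B′ : Matrix
    A′ i j = H (a ⁺) i j + - 1# * H′ a i j
    B′ i l = H′ (a ⁺) i l + - 1# * H a i l
    cleared : ∀ i l → B′ i l + [0< l ] * A′ i (ℕ.pred l) ≈ 0#
    cleared i zero    = trans (+-cong (trans (+-cong (H′-⁺-0 a i) (-1*x≈-x _)) (-‿inverseʳ _)) (zeroˡ _)) (+-identityʳ 0#)
    cleared i (suc l) = trans (+-cong (+-congʳ (H′-⁺ a i l)) (*-congˡ (+-congʳ (H-⁺ a i l))))
                              (differences-cancel (H a i (suc l)) (H′ a i l))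
    spColumn : ∀ k l → H a k l + [0< l ] * H′ a k (ℕ.pred l) ≈ spMatrix a k l
    spColumn k zero    = trans (+-congˡ (zeroˡ _)) (+-identityʳ _)
    spColumn k (suc l) = trans (+-congˡ (*-identityˡ _)) (sym (spMatrix-suc a k l))

  -- The rs matrices of the last two identities have rows c ↦ x p c and their reflections
  -- c ↦ x (p + 1) (w - c), evaluated at integer column offsets c.
  module RsPair (m : ℕ) (a : ℕ → ℤ) (s : ℤ) where
    n : ℕ
    n = suc m

    x : ℕ → ℤ → Carrier
    x p c = h (a p ℤ.- + suc p ℤ.+ c)

    w : ℤ
    w = + 2 ℤ.+ s

    reflected : ℕ → ℤ → Carrier
    reflected k c = x (suc k) (w ℤ.- c)

    left right left′ right′ : ℕ → ℤ
    left   j = + suc j ℤ.+ s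
    right  l = s ℤ.- + l
    left′  j = + j ℤ.+ s
    right′ l = s ℤ.- + suc l

    grid : ℕ → (ℕ → ℤ) → (ℕ → ℤ) → Matrix
    grid N L R = block N (λ i j → x i (L j)) (λ i l → x i (R l)) (λ k j → reflected k (L j)) (λ k l → reflected k (R l))

    a₁ b₁ a₂ b₂ : ℕ → ℤ
    a₁ k = a k ℤ.+ s
    b₁ k = a (suc k)
    a₂ k = a k ℤ.+ s ℤ.- + 1
    b₂ k = a (suc k) ℤ.+ + 1

    private
      x-cong : ∀ p {c d} → c ≡ d → x p c ≈ x p d
      x-cong p c≡d = reflexive (≡.cong (λ c → x p c) c≡d)

      h-cong : ∀ {c d} → c ≡ d → h c ≈ h d
      h-cong c≡d = reflexive (≡.cong h c≡d)

    H-a₁ : ∀ i j → H a₁ i j ≈ x i (left j)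
    H-a₁ i j = h-cong (shift (a i) s (+ i) (+ j))
      where
      shift : ∀ a s i j → a ℤ.+ s ℤ.- (+ 1 ℤ.+ i) ℤ.+ (+ 1 ℤ.+ j) ≡ a ℤ.- (+ 1 ℤ.+ i) ℤ.+ ((+ 1 ℤ.+ j) ℤ.+ s)
      shift = solve-∀

    H′-a₁ : ∀ i l → H′ a₁ i l ≈ x i (right l)
    H′-a₁ i l = h-cong (shift (a i) s (+ i) (+ l))
      where
      shift : ∀ a s i l → a ℤ.+ s ℤ.- (+ 1 ℤ.+ i) ℤ.- (+ 1 ℤ.+ l) ℤ.+ + 1 ≡ a ℤ.- (+ 1 ℤ.+ i) ℤ.+ (s ℤ.- l)
      shift = solve-∀

    H′-b₁ : ∀ k j → H′ b₁ k j ≈ reflected k (left j)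
    H′-b₁ k j = h-cong (shift (a (suc k)) s (+ k) (+ j))
      where
      shift : ∀ a s k j → a ℤ.- (+ 1 ℤ.+ k) ℤ.- (+ 1 ℤ.+ j) ℤ.+ + 1 ≡ a ℤ.- (+ 2 ℤ.+ k) ℤ.+ ((+ 2 ℤ.+ s) ℤ.- ((+ 1 ℤ.+ j) ℤ.+ s))
      shift = solve-∀

    H-b₁ : ∀ k l → H b₁ k l ≈ reflected k (right l)
    H-b₁ k l = h-cong (shift (a (suc k)) s (+ k) (+ l))
      where
      shift : ∀ a s k l → a ℤ.- (+ 1 ℤ.+ k) ℤ.+ (+ 1 ℤ.+ l) ≡ a ℤ.- (+ 2 ℤ.+ k) ℤ.+ ((+ 2 ℤ.+ s) ℤ.- (s ℤ.- l))
      shift = solve-∀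

    H-a₂ : ∀ i j → H a₂ i j ≈ x i (left′ j)
    H-a₂ i j = h-cong (shift (a i) s (+ i) (+ j))
      where
      shift : ∀ a s i j → a ℤ.+ s ℤ.- + 1 ℤ.- (+ 1 ℤ.+ i) ℤ.+ (+ 1 ℤ.+ j) ≡ a ℤ.- (+ 1 ℤ.+ i) ℤ.+ (j ℤ.+ s)
      shift = solve-∀

    H′-a₂ : ∀ i l → H′ a₂ i l ≈ x i (right′ l)
    H′-a₂ i l = h-cong (shift (a i) s (+ i) (+ l))
      where
      shift : ∀ a s i l → a ℤ.+ s ℤ.- + 1 ℤ.- (+ 1 ℤ.+ i) ℤ.- (+ 1 ℤ.+ l) ℤ.+ + 1 ≡ a ℤ.- (+ 1 ℤ.+ i) ℤ.+ (s ℤ.- (+ 1 ℤ.+ l))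
      shift = solve-∀

    H′-b₂ : ∀ k j → H′ b₂ k j ≈ reflected k (left′ j)
    H′-b₂ k j = h-cong (shift (a (suc k)) s (+ k) (+ j))
      where
      shift : ∀ a s k j → a ℤ.+ + 1 ℤ.- (+ 1 ℤ.+ k) ℤ.- (+ 1 ℤ.+ j) ℤ.+ + 1 ≡ a ℤ.- (+ 2 ℤ.+ k) ℤ.+ ((+ 2 ℤ.+ s) ℤ.- (j ℤ.+ s))
      shift = solve-∀

    H-b₂ : ∀ k l → H b₂ k l ≈ reflected k (right′ l)
    H-b₂ k l = h-cong (shift (a (suc k)) s (+ k) (+ l))
      where
      shift : ∀ a s k l → a ℤ.+ + 1 ℤ.- (+ 1 ℤ.+ k) ℤ.+ (+ 1 ℤ.+ l) ≡ a ℤ.- (+ 2 ℤ.+ k) ℤ.+ ((+ 2 ℤ.+ s) ℤ.- (s ℤ.- (+ 1 ℤ.+ l)))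
      shift = solve-∀

    module _ {α₁ β₁ : Fin n → ℤ} (α₁≡ : ∀ i → α₁ i ≡ a₁ (toℕ i)) (β₁≡ : ∀ i → β₁ i ≡ b₁ (toℕ i)) where
      rs≈detℕ-grid : rs α₁ β₁ ≈ detℕ (n ℕ.+ n) (grid n left right)
      rs≈detℕ-grid = trans (rs≈detℕ a₁ b₁ α₁≡ β₁≡)
        (detℕ-block-cong n n (λ i j _ _ → H-a₁ i j) (λ i l _ _ → H′-a₁ i l) (λ k j _ _ → H′-b₁ k j) (λ k l _ _ → H-b₁ k l))

    module _ {α₂ : Fin (suc n) → ℤ} {β₂ : Fin m → ℤ} (α₂≡ : ∀ i → α₂ i ≡ a₂ (toℕ i)) (β₂≡ : ∀ i → β₂ i ≡ b₂ (toℕ i)) where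
      rs≈detℕ-grid′ : rs α₂ β₂ ≈ detℕ (n ℕ.+ n) (grid (suc n) left′ right′)
      rs≈detℕ-grid′ = trans (rs≈detℕ a₂ b₂ α₂≡ β₂≡) (trans
        (detℕ-block-cong (suc n) m (λ i j _ _ → H-a₂ i j) (λ i l _ _ → H′-a₂ i l) (λ k j _ _ → H′-b₂ k j) (λ k l _ _ → H-b₂ k l))
        (reflexive (≡.cong (λ K → detℕ K (grid (suc n) left′ right′)) (≡.cong suc (≡.sym (ℕ.+-suc m m))))))

    M₁ M₂ rotated : Matrix
    M₁ = grid n left right
    M₂ = grid (suc n) left′ right′
    rotated i j = M₂ (rotate n m i) (rotate 0 n j)

    -- m + n is odd
    detℕ-rotated : detℕ (n ℕ.+ n) M₂ ≈ - detℕ (n ℕ.+ n) rotated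
    detℕ-rotated = begin
      D                          ≈⟨ sym (signed-involutive (suc m) D) ⟩
      - signed m (signed n D)    ≈⟨ -‿cong (signed-cong m (sym (detℕ-rotateColumns n (n ℕ.+ n) M₂ (ℕ.m<m+n n (s≤s z≤n))))) ⟩
      - signed m (detℕ (n ℕ.+ n) (λ i j → M₂ i (rotate 0 n j)))
        ≈⟨ -‿cong (sym (detℕ-rotateRows m n (n ℕ.+ n) (λ i j → M₂ i (rotate 0 n j)) (ℕ.+-monoʳ-< n (ℕ.n<1+n m)))) ⟩
      - detℕ (n ℕ.+ n) rotated   ∎
      where
      D : Carrier
      D = detℕ (n ℕ.+ n) M₂

    -- after the rotation, column n of M₂ carries the offset left′ 0 = right 0
    module RotatedRow (r : ℕ) (f : ℤ → Carrier)
                      (onLeft : ∀ j → j < suc n → M₂ r j ≈ f (left′ j)) (onRight : ∀ l → M₂ r (suc n ℕ.+ l) ≈ f (right′ l)) where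
      leftColumn : ∀ j → j < n → M₂ r (rotate 0 n j) ≈ f (left j)
      leftColumn j j<n = trans (reflexive (≡.cong (M₂ r) (rotate-inside 0 n j z≤n j<n))) (onLeft (suc j) (s≤s j<n))

      rightColumn : ∀ l → M₂ r (rotate 0 n (n ℕ.+ l)) ≈ f (right l)
      rightColumn zero    = trans (reflexive (≡.cong (M₂ r) (≡.trans (≡.cong (rotate 0 n) (ℕ.+-identityʳ n)) (rotate-last 0 n))))
                                  (trans (onLeft 0 (s≤s z≤n)) (reflexive (≡.cong f (offset s))))
        where
        offset : ∀ s → + 0 ℤ.+ s ≡ s ℤ.- + 0
        offset = solve-∀
      rightColumn (suc l) = trans (reflexive (≡.cong (M₂ r) (≡.trans (rotate-> 0 n (n ℕ.+ suc l) (ℕ.m<m+n n (s≤s z≤n))) (ℕ.+-suc n l))))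
                                  (onRight l)

    private
      module G₁ = Block n (λ i j → x i (left j)) (λ i l → x i (right l)) (λ k j → reflected k (left j)) (λ k l → reflected k (right l))
      module G₂ = Block (suc n) (λ i j → x i (left′ j)) (λ i l → x i (right′ l)) (λ k j → reflected k (left′ j)) (λ k l → reflected k (right′ l))

      module UpperRow {i} (i<n : i < suc n) = RotatedRow i (x i) (λ j j< → G₂.upperLeft i<n j<) (λ l → G₂.upperRight l i<n)
      module LowerRow (k : ℕ) = RotatedRow (suc n ℕ.+ k) (reflected k) (λ j j< → G₂.lowerLeft k j<) (λ l → G₂.lowerRight k l)

      rotated-upper : ∀ {i} j → i < n → rotated i j ≡ M₂ i (rotate 0 n j)
      rotated-upper {i} j i<n = ≡.cong (λ r → M₂ r (rotate 0 n j)) (rotate-< n m i i<n)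

      rotated-lower : ∀ k j → k < m → rotated (n ℕ.+ k) j ≡ M₂ (suc n ℕ.+ k) (rotate 0 n j)
      rotated-lower k j k<m = ≡.cong (λ r → M₂ r (rotate 0 n j)) (rotate-inside n m (n ℕ.+ k) (ℕ.m≤m+n n k) (ℕ.+-monoʳ-< n k<m))

      rotated-last : ∀ j → rotated (n ℕ.+ m) j ≡ M₂ n (rotate 0 n j)
      rotated-last j = ≡.cong (λ r → M₂ r (rotate 0 n j)) (rotate-last n m)

      lower<m : ∀ {k} → k < n → n ℕ.+ k ≢ n ℕ.+ m → k < m
      lower<m (s≤s k≤m) n+k≢n+m = ℕ.≤∧≢⇒< k≤m (λ k≡m → n+k≢n+m (≡.cong (n ℕ.+_) k≡m))

    M₁≈rotated : ∀ i j → i < n ℕ.+ n → j < n ℕ.+ n → i ≢ n ℕ.+ m → M₁ i j ≈ rotated i j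
    M₁≈rotated = byBlocks n n _
      (λ i j i< j< _ → trans (G₁.upperLeft i< j<)
                         (sym (trans (reflexive (rotated-upper j i<)) (UpperRow.leftColumn (ℕ.m<n⇒m<1+n i<) j j<))))
      (λ i l i< _ _ → trans (G₁.upperRight l i<)
                         (sym (trans (reflexive (rotated-upper (n ℕ.+ l) i<)) (UpperRow.rightColumn (ℕ.m<n⇒m<1+n i<) l))))
      (λ k j k< j< ≢last → trans (G₁.lowerLeft k j<)
                         (sym (trans (reflexive (rotated-lower k j (lower<m k< ≢last))) (LowerRow.leftColumn k j j<))))
      (λ k l k< _ ≢last → trans (G₁.lowerRight k l)
                         (sym (trans (reflexive (rotated-lower k (n ℕ.+ l) (lower<m k< ≢last))) (LowerRow.rightColumn k l))))

    rotated-lastRow-left : ∀ j → j < n → rotated (n ℕ.+ m) j ≈ x n (left j)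
    rotated-lastRow-left j j<n = trans (reflexive (rotated-last j)) (UpperRow.leftColumn (ℕ.n<1+n n) j j<n)

    rotated-lastRow-right : ∀ l → rotated (n ℕ.+ m) (n ℕ.+ l) ≈ x n (right l)
    rotated-lastRow-right l = trans (reflexive (rotated-last (n ℕ.+ l))) (UpperRow.rightColumn (ℕ.n<1+n n) l)

    antisymmetric : ℕ → ℤ → Carrier
    antisymmetric k c = reflected k c + - 1# * x (suc k) c

    private
      -- lower row k gets upper row k + 1 back, except the last lower row, which has no such partner
      next : ℕ → ℕ
      next k with k ℕ.<? m
      ... | yes _ = suc k
      ... | no  _ = 0

      restore : ℕ → Carrier
      restore k with k ℕ.<? m
      ... | yes _ = 1#
      ... | no  _ = 0#

      next<n : ∀ k → k < n → next k < n
      next<n k _ with k ℕ.<? m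
      ... | yes k<m = s≤s k<m
      ... | no  _   = s≤s z≤n

      restored : ∀ k c → k < m → antisymmetric k c + restore k * x (next k) c ≈ reflected k c
      restored k c k<m with k ℕ.<? m
      ... | no  k≮m = ⊥-elim (k≮m k<m)
      ... | yes _   = begin
        (reflected k c + - 1# * x (suc k) c) + 1# * x (suc k) c ≈⟨ +-assoc _ _ _ ⟩
        reflected k c + (- 1# * x (suc k) c + 1# * x (suc k) c) ≈⟨ +-congˡ (sym (distribʳ _ _ _)) ⟩
        reflected k c + (- 1# + 1#) * x (suc k) c               ≈⟨ +-congˡ (trans (*-congʳ (-‿inverseˡ 1#)) (zeroˡ _)) ⟩
        reflected k c + 0#                                      ≈⟨ +-identityʳ _ ⟩
        reflected k c                                           ∎

      unrestored : ∀ c → antisymmetric m c + restore m * x (next m) c ≈ antisymmetric m c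
      unrestored c with m ℕ.<? m
      ... | yes m<m = ⊥-elim (ℕ.<-irrefl ≡.refl m<m)
      ... | no  _   = trans (+-congˡ (zeroˡ _)) (+-identityʳ _)

      E : Matrix
      E = block n (λ i j → x i (left j)) (λ i l → x i (right l))
                  (λ k j → antisymmetric k (left j) + restore k * x (next k) (left j))
                  (λ k l → antisymmetric k (right l) + restore k * x (next k) (right l))
      module E = Block n (λ i j → x i (left j)) (λ i l → x i (right l))
                         (λ k j → antisymmetric k (left j) + restore k * x (next k) (left j))
                         (λ k l → antisymmetric k (right l) + restore k * x (next k) (right l))

      E≈M₁ : ∀ i j → i < n ℕ.+ n → j < n ℕ.+ n → i ≢ n ℕ.+ m → E i j ≈ M₁ i j
      E≈M₁ = byBlocks n n _
        (λ i j i< j< _ → trans (E.upperLeft i< j<) (sym (G₁.upperLeft i< j<)))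
        (λ i l i< _ _ → trans (E.upperRight l i<) (sym (G₁.upperRight l i<)))
        (λ k j k< j< ≢last → trans (E.lowerLeft k j<) (trans (restored k (left j) (lower<m k< ≢last)) (sym (G₁.lowerLeft k j<))))
        (λ k l k< _ ≢last → trans (E.lowerRight k l) (trans (restored k (right l) (lower<m k< ≢last)) (sym (G₁.lowerRight k l))))

      E-lastRow : ∀ j → j < n ℕ.+ n → E (n ℕ.+ m) j ≈ M₁ (n ℕ.+ m) j + - 1# * rotated (n ℕ.+ m) j
      E-lastRow j j< with half n j
      ... | upper j<n = trans (E.lowerLeft m j<n) (trans (unrestored (left j))
                          (sym (+-cong (G₁.lowerLeft m j<n) (*-congˡ (rotated-lastRow-left j j<n)))))
      ... | lower l   = trans (E.lowerRight m l) (trans (unrestored (right l))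
                          (sym (+-cong (G₁.lowerRight m l) (*-congˡ (rotated-lastRow-right l)))))

    -- The two determinants agree except in the last row, so their difference is one determinant.
    rs-pair : ∀ {α₁ β₁ : Fin n → ℤ} {α₂ : Fin (suc n) → ℤ} {β₂ : Fin m → ℤ} →
      (∀ i → α₁ i ≡ a₁ (toℕ i)) → (∀ i → β₁ i ≡ b₁ (toℕ i)) → (∀ i → α₂ i ≡ a₂ (toℕ i)) → (∀ i → β₂ i ≡ b₂ (toℕ i)) →
      rs α₁ β₁ + rs α₂ β₂ ≈ detℕ (n ℕ.+ n) (block n (λ i j → x i (left j)) (λ i l → x i (right l))
                                                    (λ k j → antisymmetric k (left j)) (λ k l → antisymmetric k (right l)))
    rs-pair α₁≡ β₁≡ α₂≡ β₂≡ = begin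
      _ + _                                            ≈⟨ +-cong (rs≈detℕ-grid α₁≡ β₁≡) (trans (rs≈detℕ-grid′ α₂≡ β₂≡) detℕ-rotated) ⟩
      detℕ (n ℕ.+ n) M₁ + - detℕ (n ℕ.+ n) rotated     ≈⟨ +-congˡ (sym (-1*x≈-x _)) ⟩
      detℕ (n ℕ.+ n) M₁ + - 1# * detℕ (n ℕ.+ n) rotated
        ≈⟨ sym (detℕ-linearInRow (n ℕ.+ m) (n ℕ.+ n) E M₁ rotated (- 1#) (ℕ.+-monoʳ-< n (ℕ.n<1+n m))
                  E≈M₁ (λ i j i< j< ≢last → trans (E≈M₁ i j i< j< ≢last) (M₁≈rotated i j i< j< ≢last)) E-lastRow) ⟩
      detℕ (n ℕ.+ n) E
        ≈⟨ detℕ-block-addToLowerRows n n _ _ _ _ _ _ next restore next<n (λ _ _ _ _ → refl) (λ _ _ _ _ → refl) ⟩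
      _ ∎

    antisymmetric-fixed : ∀ k c → c ≡ w ℤ.- c → antisymmetric k c ≈ 0#
    antisymmetric-fixed k c c≡w-c = trans (+-cong (x-cong (suc k) (≡.sym c≡w-c)) (-1*x≈-x _)) (-‿inverseʳ _)

    antisymmetric-cancel : ∀ k c d → d ≡ w ℤ.- c → antisymmetric k c + 1# * antisymmetric k d ≈ 0#
    antisymmetric-cancel k c d ≡.refl =
      trans (+-congˡ (*-congˡ (+-congʳ (x-cong (suc k) (involutive w c))))) (differences-cancel (x (suc k) c) (reflected k c))
      where
      involutive : ∀ w c → w ℤ.- (w ℤ.- c) ≡ c
      involutive = solve-∀

  module _ {m : ℕ} (α : Fin (suc (suc m)) → ℤ) where
    private
      a : ℕ → ℤ
      a = extend (+ 0) α

      a-toℕ : ∀ i → α i ≡ a (toℕ i)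
      a-toℕ i = ≡.sym (extend-toℕ (+ 0) α i)

      a-inject₁ : ∀ i → α (inject₁ i) ≡ a (toℕ i)
      a-inject₁ i = ≡.trans (a-toℕ (inject₁ i)) (≡.cong a (Fin.toℕ-inject₁ i))

      a-suc-inject₁ : ∀ i → α (suc (inject₁ i)) ℤ.+ + 1 ≡ a (suc (toℕ i)) ℤ.+ + 1
      a-suc-inject₁ i = ≡.cong (ℤ._+ + 1) (≡.trans (a-toℕ (suc (inject₁ i))) (≡.cong (λ k → a (suc k)) (Fin.toℕ-inject₁ i)))

    rs-pair-sp-o : rs (λ i → α (inject₁ i)) (λ i → α (suc i)) + rs (λ i → α i ℤ.- + 1) (λ i → α (suc (inject₁ i)) ℤ.+ + 1)
                   ≈ sp (λ i → α (inject₁ i)) * o (λ i → α (suc i))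
    rs-pair-sp-o = begin
      _ ≈⟨ rs-pair α₁≡ (λ i → a-toℕ (suc i)) α₂≡ a-suc-inject₁ ⟩
      detℕ (n ℕ.+ n) (block n (λ i j → x i (left j)) (λ i l → x i (right l))
                              (λ k j → antisymmetric k (left j)) (λ k l → antisymmetric k (right l)))
        ≈⟨ detℕ-block-clearLowerLeft n n _ _ _ _ ℕ.pred [0<_] (λ j j< → ℕ.≤-<-trans ℕ.pred[n]≤n j<) (λ k j _ _ → cleared k j) ⟩
      detℕ n (λ i j → x i (left j) + [0< j ] * x i (right (ℕ.pred j))) * detℕ n (λ k l → antisymmetric k (right l))
        ≈⟨ *-cong (detℕ-cong n (λ i j _ _ → spEntry i j)) (detℕ-cong n (λ k l _ _ → oEntry k l)) ⟩
      detℕ n (spMatrix a₁) * detℕ n (λ i j → H b₁ i j - Hᵒ b₁ i j)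
        ≈⟨ sym (*-cong (sp≈detℕ a₁ α₁≡) (o≈detℕ b₁ (λ i → a-toℕ (suc i)))) ⟩
      sp (λ i → α (inject₁ i)) * o (λ i → α (suc i)) ∎
      where
      open RsPair m a (+ 0)
      α₁≡ : ∀ i → α (inject₁ i) ≡ a₁ (toℕ i)
      α₁≡ i = ≡.trans (a-inject₁ i) (≡.sym (ℤ.+-identityʳ _))
      α₂≡ : ∀ i → α i ℤ.- + 1 ≡ a₂ (toℕ i)
      α₂≡ i = ≡.cong (ℤ._- + 1) (≡.trans (a-toℕ i) (≡.sym (ℤ.+-identityʳ _)))
      cleared : ∀ k j → antisymmetric k (left j) + [0< j ] * antisymmetric k (right (ℕ.pred j)) ≈ 0#
      cleared k zero    = trans (+-cong (antisymmetric-fixed k (left 0) ≡.refl) (zeroˡ _)) (+-identityʳ 0#)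
      cleared k (suc j) = antisymmetric-cancel k (left (suc j)) (right j) (offset (+ j))
        where
        offset : ∀ j → + 0 ℤ.- j ≡ (+ 2 ℤ.+ + 0) ℤ.- ((+ 2 ℤ.+ j) ℤ.+ + 0)
        offset = solve-∀
      spEntry : ∀ i j → x i (left j) + [0< j ] * x i (right (ℕ.pred j)) ≈ spMatrix a₁ i j
      spEntry i zero    = trans (+-congˡ (zeroˡ _)) (trans (+-identityʳ _) (sym (H-a₁ i 0)))
      spEntry i (suc j) = trans (+-cong (sym (H-a₁ i (suc j))) (trans (*-identityˡ _) (sym (H′-a₁ i j))))
                                (sym (spMatrix-suc a₁ i j))
      oEntry : ∀ k l → antisymmetric k (right l) ≈ H b₁ k l - Hᵒ b₁ k l
      oEntry k l = +-cong (sym (H-b₁ k l)) (trans (-1*x≈-x _) (-‿cong (reflexive (≡.cong h (shift (a (suc k)) (+ k) (+ l))))))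
        where
        shift : ∀ a k l → a ℤ.- (+ 2 ℤ.+ k) ℤ.+ (+ 0 ℤ.- l) ≡ a ℤ.- (+ 1 ℤ.+ k) ℤ.- (+ 1 ℤ.+ l)
        shift = solve-∀

    rs-pair-so-so⁻ : rs (λ i → α (inject₁ i) ℤ.+ + 1) (λ i → α (suc i)) + rs α (λ i → α (suc (inject₁ i)) ℤ.+ + 1)
                     ≈ so (λ i → α (inject₁ i) ℤ.+ + 1) * so⁻ (λ i → α (suc i))
    rs-pair-so-so⁻ = begin
      _ ≈⟨ rs-pair α₁≡ (λ i → a-toℕ (suc i)) α₂≡ a-suc-inject₁ ⟩
      detℕ (n ℕ.+ n) (block n (λ i j → x i (left j)) (λ i l → x i (right l))
                              (λ k j → antisymmetric k (left j)) (λ k l → antisymmetric k (right l)))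
        ≈⟨ detℕ-block-clearLowerLeft n n _ _ _ _ (λ j → j) (λ _ → 1#) (λ _ j< → j<) (λ k j _ _ → cleared k j) ⟩
      detℕ n (λ i j → x i (left j) + 1# * x i (right j)) * detℕ n (λ k l → antisymmetric k (right l))
        ≈⟨ *-cong (detℕ-cong n (λ i j _ _ → +-cong (sym (H-a₁ i j)) (trans (*-identityˡ _) (sym (H′-a₁ i j)))))
                  (detℕ-cong n (λ k l _ _ → so⁻Entry k l)) ⟩
      detℕ n (λ i j → H a₁ i j + H′ a₁ i j) * detℕ n (λ i j → H b₁ i j - H′ b₁ i j)
        ≈⟨ sym (*-cong (so≈detℕ a₁ α₁≡) (so⁻≈detℕ b₁ (λ i → a-toℕ (suc i)))) ⟩
      so (λ i → α (inject₁ i) ℤ.+ + 1) * so⁻ (λ i → α (suc i)) ∎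
      where
      open RsPair m a (+ 1)
      α₁≡ : ∀ i → α (inject₁ i) ℤ.+ + 1 ≡ a₁ (toℕ i)
      α₁≡ i = ≡.cong (ℤ._+ + 1) (a-inject₁ i)
      α₂≡ : ∀ i → α i ≡ a₂ (toℕ i)
      α₂≡ i = ≡.trans (a-toℕ i) (cancel (a (toℕ i)))
        where
        cancel : ∀ a → a ≡ a ℤ.+ + 1 ℤ.- + 1
        cancel = solve-∀
      cleared : ∀ k j → antisymmetric k (left j) + 1# * antisymmetric k (right j) ≈ 0#
      cleared k j = antisymmetric-cancel k (left j) (right j) (offset (+ j))
        where
        offset : ∀ j → + 1 ℤ.- j ≡ (+ 2 ℤ.+ + 1) ℤ.- ((+ 1 ℤ.+ j) ℤ.+ + 1)
        offset = solve-∀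
      so⁻Entry : ∀ k l → antisymmetric k (right l) ≈ H b₁ k l - H′ b₁ k l
      so⁻Entry k l = +-cong (sym (H-b₁ k l)) (trans (-1*x≈-x _) (-‿cong (reflexive (≡.cong h (shift (a (suc k)) (+ k) (+ l))))))
        where
        shift : ∀ a k l → a ℤ.- (+ 2 ℤ.+ k) ℤ.+ (+ 1 ℤ.- l) ≡ a ℤ.- (+ 1 ℤ.+ k) ℤ.- (+ 1 ℤ.+ l) ℤ.+ + 1
        shift = solve-∀

-- All four identities hold for arbitrary integer sequences, so the partition hypotheses are unused.
theorem6p3 : ∀ {c ℓ : Level} (R : CommutativeRing c ℓ)
    (g : ℕ → CommutativeRing.Carrier R) (m : ℕ) →
    let open CommutativeRing R
        open Sym R g
    in (∀ (lam : Fin (suc m) → ℕ) → IsPartition lam →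
          (rs (λ i → + lam i) (λ i → + lam i)
             ≈ so (λ i → + lam i) * so⁻ (λ i → + lam i))
        × (rs (λ i → + lam i ℤ.+ + 1) (λ i → + lam i)
             ≈ o (λ i → + lam i ℤ.+ + 1) * sp (λ i → + lam i)))
     × (∀ (lam : Fin (suc (suc m)) → ℕ) → IsPartition lam →
          ((rs (λ i → + lam (inject₁ i)) (λ i → + lam (suc i))
            + rs (λ i → + lam i ℤ.- + 1) (λ i → + lam (suc (inject₁ i)) ℤ.+ + 1))
             ≈ sp (λ i → + lam (inject₁ i)) * o (λ i → + lam (suc i)))
        × ((rs (λ i → + lam (inject₁ i) ℤ.+ + 1) (λ i → + lam (suc i))
            + rs (λ i → + lam i) (λ i → + lam (suc (inject₁ i)) ℤ.+ + 1))
             ≈ so (λ i → + lam (inject₁ i) ℤ.+ + 1) * so⁻ (λ i → + lam (suc i))))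
theorem6p3 R g m =
    (λ lam _ → rs-diagonal (λ i → + lam i) , rs-shifted (λ i → + lam i))
  , (λ lam _ → rs-pair-sp-o (λ i → + lam i) , rs-pair-so-so⁻ (λ i → + lam i))
  where open SymmetricFunctions R g
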